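{- A sparse paving set system is a sparse paving delta-matroid if and only if it has no minor isomorphic to a set system in $\{S_i: i\ge3\}\cup\{T_2,\ T_2^*,\ T_3*b,\ T_4*b,\ T_4*\{a,c\}\}$.
   Context: A set system is a pair $S=(E,\mathcal{F})$ with $E$ finite and $\mathcal{F}$ a collection of subsets of $E$; it is proper if $\mathcal{F}\neq\emptyset$. Isomorphism: a bijection $\phi:E\to E'$ with $A\in\mathcal{F}\iff\phi(A)\in\mathcal{F}'$. For proper $S$ and $e\in E$: $e$ is a loop if no feasible set contains $e$, a coloop if every feasible set contains $e$. If $e$ is not a loop, $S/e=(E-e,\{F-e:e\in F\in\mathcal{F}\})$; if $e$ is not a coloop, $S\backslash e=(E-e,\{F\in\mathcal{F}:e\notin F\})$; if $e$ is a loop or coloop, $S/e$ and $S\backslash e$ are both set equal to whichever was defined. A minor is any set system obtained by a (possibly empty) sequence of such operations. Twist: $S*A=(E,\{F\triangle A:F\in\mathcal{F}\})$, $S*b=S*\{b\}$, dual $S^*=S*E$. A delta-matroid is a proper set system such that for all $X,Y\in\mathcal{F}$ and $u\in X\triangle Y$ there is $v\in X\triangle Y$ (possibly $v=u$) with $X\triangle\{u,v\}\in\mathcal{F}$. The stack of a proper $S$ with smallest feasible sets of size $k$ and largest of size $\ell$ is $N_k,\ldots,N_\ell$, $N_i=(E,\{F\in\mathcal{F}:|F|=i\})$. A rank-$r$ matroid is paving if every circuit has at least $r$ elements, and sparse paving if it and its dual are paving. $S$ is a sparse paving set system if every proper $N_i$ is (the set of bases of) a sparse paving matroid on $E$; a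 sparse paving delta-matroid is a sparse paving set system that is a delta-matroid. $S_i=(\{e_1,\ldots,e_i\},\{\emptyset,\{e_1,\ldots,e_i\}\})$; $T_2=(\{a,b,c\},\{\emptyset,\{a,b\},\{a,c\},\{a,b,c\}\})$; $T_3=(\{a,b,c\},\{\emptyset,\{a\},\{a,b\},\{a,b,c\}\})$; $T_4=(\{a,b,c\},\{\emptyset,\{a\},\{a,b\},\{a,c\},\{a,b,c\}\})$. -}

module Defs where

open import Data.Nat using (ℕ; zero; suc; _≤_; _≡ᵇ_)
open import Data.Bool using (Bool; true; false; _∧_; _∨_; _xor_; if_then_else_)
open import Data.Fin using (Fin; zero; suc) renaming (_≟_ to _≟ᶠ_)
open import Data.Fin.Subset using (Subset; _∈_; _∉_; _⊆_; _⊂_; ∁; _∪_; _-_; ⁅_⁆; ∣_∣)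
  renaming (⊥ to ∅; ⊤ to full)
open import Data.Vec using (Vec; []; _∷_; zipWith; insertAt; tabulate; lookup)
open import Data.Vec.Properties using (≡-dec)
open import Data.List using (List; []; _∷_)
open import Data.Bool.ListAction using (any)
open import Data.Sum using (_⊎_)
open import Data.Product using (Σ; ∃; _×_; _,_)
open import Relation.Nullary using (¬_; ⌊_⌋)
open import Relation.Binary.PropositionalEquality using (_≡_)
open import Function.Definitions using (Bijective)
import Data.Bool as B

SetSystem : ℕ → Set
SetSystem n = Subset n → Bool

Feasible : ∀ {n} → SetSystem n → Subset n → Set
Feasible S A = S A ≡ true

Proper : ∀ {n} → SetSystem n → Set
Proper S = ∃ λ A → Feasible S A

_△_ : ∀ {n} → Subset n → Subset n → Subset n
_△_ = zipWith _xor_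

_==_ : ∀ {n} → Subset n → Subset n → Bool
A == B = ⌊ ≡-dec B._≟_ A B ⌋

fromList : ∀ {n} → List (Subset n) → SetSystem n
fromList L A = any (λ B → A == B) L

anyFin : ∀ {n} → (Fin n → Bool) → Bool
anyFin {zero}  f = false
anyFin {suc n} f = f zero ∨ anyFin (λ i → f (suc i))

image : ∀ {n m} → (Fin n → Fin m) → Subset n → Subset m
image φ A = tabulate (λ y → anyFin (λ x → lookup A x ∧ ⌊ φ x ≟ᶠ y ⌋))

Isomorphic : ∀ {n m} → SetSystem n → SetSystem m → Set
Isomorphic {n} {m} S S′ =
  Σ (Fin n → Fin m) λ φ → Bijective _≡_ _≡_ φ × (∀ A → S A ≡ S′ (image φ A))

-- For e : Fin (suc n), insertAt A e b is the subset of Fin (suc n)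
-- obtained from A ⊆ E - e (identified with Fin n) by adding e (b = true)
-- or not (b = false).

Loop : ∀ {n} → SetSystem n → Fin n → Set
Loop S e = ∀ A → Feasible S A → e ∉ A

Coloop : ∀ {n} → SetSystem n → Fin n → Set
Coloop S e = ∀ A → Feasible S A → e ∈ A

contract : ∀ {n} → SetSystem (suc n) → Fin (suc n) → SetSystem n
contract S e A = S (insertAt A e true)

delete : ∀ {n} → SetSystem (suc n) → Fin (suc n) → SetSystem n
delete S e A = S (insertAt A e false)

-- Contraction of e is allowed when e is not
-- a loop, deletion when e is not a coloop.  (For a proper set system, if e
-- is a loop then S/e := S\e, and if e is a coloop then S\e := S/e, so these
-- two rules produce exactly the minors of the paper.)
data Minor {n : ℕ} (S : SetSystem n) : ∀ {m} → SetSystem m → Set where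
  self     : Minor S S
  contract-step : ∀ {m} {M : SetSystem (suc m)} (e : Fin (suc m)) →
             Minor S M → ¬ Loop M e → Minor S (contract M e)
  delete-step   : ∀ {m} {M : SetSystem (suc m)} (e : Fin (suc m)) →
             Minor S M → ¬ Coloop M e → Minor S (delete M e)

twist : ∀ {n} → SetSystem n → Subset n → SetSystem n
twist S A B = S (B △ A)

dual : ∀ {n} → SetSystem n → SetSystem n
dual S = twist S full

IsDeltaMatroid : ∀ {n} → SetSystem n → Set
IsDeltaMatroid S = Proper S ×
  (∀ X Y → Feasible S X → Feasible S Y → ∀ u → u ∈ (X △ Y) →
     ∃ λ v → v ∈ (X △ Y) × Feasible S (X △ (⁅ u ⁆ ∪ ⁅ v ⁆)))

IsMatroidBases : ∀ {n} → SetSystem n → Set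
IsMatroidBases 𝓑 = Proper 𝓑 ×
  (∀ B₁ B₂ → Feasible 𝓑 B₁ → Feasible 𝓑 B₂ → ∀ x → x ∈ B₁ → x ∉ B₂ →
     ∃ λ y → y ∈ B₂ × y ∉ B₁ × Feasible 𝓑 ((B₁ - x) ∪ ⁅ y ⁆))

Independent : ∀ {n} → SetSystem n → Subset n → Set
Independent 𝓑 I = ∃ λ B → Feasible 𝓑 B × I ⊆ B

Circuit : ∀ {n} → SetSystem n → Subset n → Set
Circuit 𝓑 C = ¬ Independent 𝓑 C × (∀ D → D ⊂ C → Independent 𝓑 D)

IsPaving : ∀ {n} → SetSystem n → Set
IsPaving 𝓑 = ∀ C B → Circuit 𝓑 C → Feasible 𝓑 B → ∣ B ∣ ≤ ∣ C ∣

dualBases : ∀ {n} → SetSystem n → SetSystem n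
dualBases 𝓑 A = 𝓑 (∁ A)

IsSparsePavingMatroid : ∀ {n} → SetSystem n → Set
IsSparsePavingMatroid 𝓑 =
  IsMatroidBases 𝓑 × IsPaving 𝓑 × IsPaving (dualBases 𝓑)

layer : ∀ {n} → SetSystem n → ℕ → SetSystem n
layer S i A = S A ∧ (∣ A ∣ ≡ᵇ i)

IsSparsePavingSetSystem : ∀ {n} → SetSystem n → Set
IsSparsePavingSetSystem S = Proper S ×
  (∀ i → Proper (layer S i) → IsSparsePavingMatroid (layer S i))

IsSparsePavingDeltaMatroid : ∀ {n} → SetSystem n → Set
IsSparsePavingDeltaMatroid S = IsSparsePavingSetSystem S × IsDeltaMatroid S

Sys : (i : ℕ) → SetSystem i
Sys i = fromList (∅ ∷ full ∷ [])

-- ground set {a, b, c} = Fin 3 with a = 0, b = 1, c = 2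
pattern o = false
pattern I = true

T₂ : SetSystem 3
T₂ = fromList ((o ∷ o ∷ o ∷ []) ∷ (I ∷ I ∷ o ∷ []) ∷ (I ∷ o ∷ I ∷ []) ∷ (I ∷ I ∷ I ∷ []) ∷ [])

T₃ : SetSystem 3
T₃ = fromList ((o ∷ o ∷ o ∷ []) ∷ (I ∷ o ∷ o ∷ []) ∷ (I ∷ I ∷ o ∷ []) ∷ (I ∷ I ∷ I ∷ []) ∷ [])

T₄ : SetSystem 3
T₄ = fromList ((o ∷ o ∷ o ∷ []) ∷ (I ∷ o ∷ o ∷ []) ∷ (I ∷ I ∷ o ∷ []) ∷ (I ∷ o ∷ I ∷ [])
               ∷ (I ∷ I ∷ I ∷ []) ∷ [])

setB : Subset 3
setB = o ∷ I ∷ o ∷ []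

setAC : Subset 3
setAC = I ∷ o ∷ I ∷ []

IsExcluded : ∀ {m} → SetSystem m → Set
IsExcluded M =
  (∃ λ i → 3 ≤ i × Isomorphic M (Sys i))
  ⊎ Isomorphic M T₂
  ⊎ Isomorphic M (dual T₂)
  ⊎ Isomorphic M (twist T₃ setB)
  ⊎ Isomorphic M (twist T₄ setB)
  ⊎ Isomorphic M (twist T₄ setAC)

{-# OPTIONS --safe #-}

-- Minors and isomorphic copies of delta-matroids are delta-matroids, and none
-- of the excluded systems is one. Conversely, take a failure X, Y, u of the
-- exchange axiom with |X △ Y| minimal and look at the minor on D = X △ Y. By
-- minimality, the only feasible set between X and Y agreeing with Y at u is Y,
-- and any one agreeing with X at u other than X is Y △ {u, v}. If |D| ≤ 2 then
-- Y itself is X △ {u, v}. If |D| = 3, the minor is a three-element system in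
-- which X, its complement and the sparse paving exchange property force one of
-- the excluded systems; this is checked by exhaustive search. If |D| ≥ 4,
-- sparse paving exchange (two non-bases are never at distance two) makes X
-- constant on D and leaves X, Y as the only feasible sets between them, so the
-- minor is S_|D|.

module Submission where

open import Defs
open import Data.Nat using (ℕ)
open import Data.Product using (_×_)
open import Relation.Nullary using (¬_)

open import Data.Nat using (zero; suc; _+_; _≤_; _<_; z≤n; s≤s) renaming (_≟_ to _≟ℕ_)
import Data.Nat.Properties as ℕₚ
open import Data.Bool using (Bool; true; false; not; _∧_; _∨_; _xor_; T; if_then_else_)
open import Data.Bool.Properties
  using ( not-involutive; not-injective; ¬-not; not-¬; xor-identityʳ; xor-same; xor-assoc; ∨-idem
        ; ∨-zeroʳ; ∨-identityʳ; ∧-zeroʳ; ∧-identityʳ; T-≡; T-∧; ⇔→≡ )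
  renaming (_≟_ to _≟ᵇ_)
open import Data.Maybe using (Maybe; just; nothing)
open import Data.Fin using (Fin; zero; suc; _≟_; punchIn; punchOut; #_)
import Data.Fin.Properties as Finₚ
open import Data.Fin.Properties using (any?; all?)
open import Data.Fin.Subset using (Subset; _∈_; _∉_; _⊆_; _⊂_; ∁; _∪_; _-_; ⁅_⁆; ∣_∣)
  renaming (⊥ to ∅; ⊤ to full)
import Data.Fin.Subset.Properties as Subsetₚ
open import Data.Fin.Subset.Properties using (anySubset?)
open import Data.Vec using (Vec; []; _∷_; lookup; insertAt; removeAt; replicate; tabulate; zipWith; _[_]%=_)
import Data.Vec.Properties as Vecₚ
open import Data.Product using (Σ; ∃; ∃₂; _,_; proj₁; proj₂)
import Data.Sum as Sum
open import Data.Sum using (_⊎_; inj₁; inj₂; [_,_]′)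
open import Data.Unit using (⊤; tt)
open import Data.Empty using (⊥; ⊥-elim)
open import Function using (_∘_; _$_)
open import Function.Bundles using (Equivalence; _⇔_; mk⇔)
open import Function.Definitions using (Bijective)
open import Relation.Nullary using (Dec; yes; no; does; ⌊_⌋; contradiction)
open import Relation.Nullary.Decidable
  using (¬?; _×-dec_; _⊎-dec_; _→-dec_; map′; decidable-stable; toWitness; fromWitness; toSum)
open import Relation.Binary.PropositionalEquality hiding (J)

true≢false : true ≢ false
true≢false ()

xor-true : ∀ b → b xor true ≡ not b
xor-true true  = refl
xor-true false = refl

⌊≟⌋-≡ : ∀ {n} (x : Fin n) → ⌊ x ≟ x ⌋ ≡ true
⌊≟⌋-≡ x with x ≟ x
... | yes _   = refl
... | no x≢x = contradiction refl x≢x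

⌊≟⌋-≢ : ∀ {n} {x y : Fin n} → x ≢ y → ⌊ x ≟ y ⌋ ≡ false
⌊≟⌋-≢ {x = x} {y} x≢y with x ≟ y
... | yes x≡y = contradiction x≡y x≢y
... | no _    = refl

∈⇒lookup : ∀ {n} {A : Subset n} {x} → x ∈ A → lookup A x ≡ true
∈⇒lookup = Vecₚ.[]=⇒lookup

lookup⇒∈ : ∀ {n} {A : Subset n} {x} → lookup A x ≡ true → x ∈ A
lookup⇒∈ = Vecₚ.lookup⇒[]= _ _

lookup⇒∉ : ∀ {n} {A : Subset n} {x} → lookup A x ≡ false → x ∉ A
lookup⇒∉ A[x]≡false x∈A = true≢false (trans (sym (∈⇒lookup x∈A)) A[x]≡false)

∉⇒lookup : ∀ {n} {A : Subset n} {x} → x ∉ A → lookup A x ≡ false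
∉⇒lookup x∉A = ¬-not (x∉A ∘ lookup⇒∈)

lookup-ext : ∀ {n} {A B : Subset n} → (∀ i → lookup A i ≡ lookup B i) → A ≡ B
lookup-ext {A = A} {B} A≗B = begin
  A                   ≡⟨ Vecₚ.tabulate∘lookup A ⟨
  tabulate (lookup A) ≡⟨ Vecₚ.tabulate-cong A≗B ⟩
  tabulate (lookup B) ≡⟨ Vecₚ.tabulate∘lookup B ⟩
  B                   ∎
  where open ≡-Reasoning

lookup-△ : ∀ {n} (A B : Subset n) i → lookup (A △ B) i ≡ lookup A i xor lookup B i
lookup-△ A B i = Vecₚ.lookup-zipWith _xor_ i A B

lookup-∪ : ∀ {n} (A B : Subset n) i → lookup (A ∪ B) i ≡ lookup A i ∨ lookup B i
lookup-∪ A B i = Vecₚ.lookup-zipWith _∨_ i A B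

lookup-∁ : ∀ {n} (A : Subset n) i → lookup (∁ A) i ≡ not (lookup A i)
lookup-∁ A i = Vecₚ.lookup-map i not A

lookup-∅ : ∀ {n} (i : Fin n) → lookup (∅ {n}) i ≡ false
lookup-∅ i = Vecₚ.lookup-replicate i false

lookup-⁅x⁆-x : ∀ {n} (x : Fin n) → lookup ⁅ x ⁆ x ≡ true
lookup-⁅x⁆-x zero    = refl
lookup-⁅x⁆-x (suc x) = lookup-⁅x⁆-x x

lookup-⁅x⁆-≢ : ∀ {n} {x y : Fin n} → x ≢ y → lookup ⁅ x ⁆ y ≡ false
lookup-⁅x⁆-≢ {x = zero}  {zero}  x≢y = contradiction refl x≢y
lookup-⁅x⁆-≢ {x = zero}  {suc y} _   = lookup-∅ y
lookup-⁅x⁆-≢ {x = suc x} {zero}  _   = refl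
lookup-⁅x⁆-≢ {x = suc x} {suc y} x≢y = lookup-⁅x⁆-≢ (x≢y ∘ cong suc)

lookup-⁅⁆ : ∀ {n} (x y : Fin n) → lookup ⁅ x ⁆ y ≡ ⌊ x ≟ y ⌋
lookup-⁅⁆ x y with x ≟ y
... | yes refl = lookup-⁅x⁆-x x
... | no x≢y   = lookup-⁅x⁆-≢ x≢y

lookup-△-pair : ∀ {n} (X : Subset n) u v y →
  lookup (X △ (⁅ u ⁆ ∪ ⁅ v ⁆)) y ≡ lookup X y xor (⌊ u ≟ y ⌋ ∨ ⌊ v ≟ y ⌋)
lookup-△-pair X u v y rewrite lookup-△ X (⁅ u ⁆ ∪ ⁅ v ⁆) y | lookup-∪ ⁅ u ⁆ ⁅ v ⁆ y
                            | lookup-⁅⁆ u y | lookup-⁅⁆ v y = refl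

≢⇒∃-lookup-≢ : ∀ {n} {A B : Subset n} → A ≢ B → ∃ λ i → lookup A i ≢ lookup B i
≢⇒∃-lookup-≢ {A = A} {B} A≢B with any? (λ i → ¬? (lookup A i ≟ᵇ lookup B i))
... | yes w = w
... | no ¬w = ⊥-elim (A≢B (lookup-ext λ i → decidable-stable (lookup A i ≟ᵇ lookup B i) (¬w ∘ (i ,_))))

toggle : ∀ {n} → Subset n → Fin n → Subset n
toggle A x = A [ x ]%= not

lookup-toggle-≡ : ∀ {n} (A : Subset n) x → lookup (toggle A x) x ≡ not (lookup A x)
lookup-toggle-≡ A x = Vecₚ.lookup∘updateAt x A

lookup-toggle-≢ : ∀ {n} (A : Subset n) {x y} → x ≢ y → lookup (toggle A x) y ≡ lookup A y
lookup-toggle-≢ A x≢y = Vecₚ.lookup∘updateAt′ _ _ (x≢y ∘ sym) A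

lookup-toggle : ∀ {n} (A : Subset n) x y → lookup (toggle A x) y ≡ lookup A y xor ⌊ x ≟ y ⌋
lookup-toggle A x y with x ≟ y
... | yes refl = trans (lookup-toggle-≡ A x) (sym (xor-true (lookup A x)))
... | no x≢y   = trans (lookup-toggle-≢ A x≢y) (sym (xor-identityʳ (lookup A y)))

toggle-involutive : ∀ {n} (A : Subset n) x → toggle (toggle A x) x ≡ A
toggle-involutive A x = trans (Vecₚ.updateAt-updateAt x A)
  (trans (Vecₚ.updateAt-cong x not-involutive A) (Vecₚ.updateAt-id x A))

toggle-comm : ∀ {n} (A : Subset n) x y → toggle (toggle A x) y ≡ toggle (toggle A y) x
toggle-comm A x y with x ≟ y
... | yes refl = refl
... | no x≢y   = Vecₚ.updateAt-commutes y x (x≢y ∘ sym) A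

∣toggle∣-∉ : ∀ {n} (A : Subset n) x → lookup A x ≡ false → ∣ toggle A x ∣ ≡ suc ∣ A ∣
∣toggle∣-∉ (false ∷ A) zero    _    = refl
∣toggle∣-∉ (true  ∷ A) (suc x) A[x] = cong suc (∣toggle∣-∉ A x A[x])
∣toggle∣-∉ (false ∷ A) (suc x) A[x] = ∣toggle∣-∉ A x A[x]

∣toggle∣-∈ : ∀ {n} (A : Subset n) x → lookup A x ≡ true → ∣ A ∣ ≡ suc ∣ toggle A x ∣
∣toggle∣-∈ (true  ∷ A) zero    _    = refl
∣toggle∣-∈ (true  ∷ A) (suc x) A[x] = cong suc (∣toggle∣-∈ A x A[x])
∣toggle∣-∈ (false ∷ A) (suc x) A[x] = ∣toggle∣-∈ A x A[x]

lookup-remove-≡ : ∀ {n} (A : Subset n) x → lookup (A - x) x ≡ false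
lookup-remove-≡ (a ∷ A) zero    = refl
lookup-remove-≡ (a ∷ A) (suc x) = lookup-remove-≡ A x

lookup-remove-≢ : ∀ {n} (A : Subset n) {x y} → x ≢ y → lookup (A - x) y ≡ lookup A y
lookup-remove-≢ (a ∷ A) {zero}  {zero}  x≢y = contradiction refl x≢y
lookup-remove-≢ (a ∷ A) {zero}  {suc y} _   = cong (λ Z → lookup Z y) (Subsetₚ.p─⊥≡p A)
lookup-remove-≢ (a ∷ A) {suc x} {zero}  _   = refl
lookup-remove-≢ (a ∷ A) {suc x} {suc y} x≢y = lookup-remove-≢ A (x≢y ∘ cong suc)

≢⇒∈△ : ∀ {n} (A B : Subset n) {i} → lookup A i ≢ lookup B i → i ∈ A △ B
≢⇒∈△ A B {i} A[i]≢B[i] = lookup⇒∈ (trans (lookup-△ A B i) (xor-≢ A[i]≢B[i]))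
  where
  xor-≢ : ∀ {a b} → a ≢ b → a xor b ≡ true
  xor-≢ {true}  {true}  a≢b = contradiction refl a≢b
  xor-≢ {true}  {false} _   = refl
  xor-≢ {false} {true}  _   = refl
  xor-≢ {false} {false} a≢b = contradiction refl a≢b

∈△⇒≢ : ∀ {n} (A B : Subset n) {i} → i ∈ A △ B → lookup A i ≢ lookup B i
∈△⇒≢ A B {i} i∈A△B A[i]≡B[i] = true≢false (begin
  true                          ≡⟨ ∈⇒lookup i∈A△B ⟨
  lookup (A △ B) i              ≡⟨ lookup-△ A B i ⟩
  lookup A i xor lookup B i     ≡⟨ cong (lookup A i xor_) A[i]≡B[i] ⟨
  lookup A i xor lookup A i     ≡⟨ xor-same (lookup A i) ⟩
  false                         ∎)
  where open ≡-Reasoning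

△-involutive : ∀ {n} (Z P : Subset n) → (Z △ P) △ P ≡ Z
△-involutive Z P = lookup-ext λ i → begin
  lookup ((Z △ P) △ P) i                        ≡⟨ lookup-△ (Z △ P) P i ⟩
  lookup (Z △ P) i xor lookup P i               ≡⟨ cong (_xor lookup P i) (lookup-△ Z P i) ⟩
  (lookup Z i xor lookup P i) xor lookup P i    ≡⟨ xor-assoc (lookup Z i) _ _ ⟩
  lookup Z i xor (lookup P i xor lookup P i)    ≡⟨ cong (lookup Z i xor_) (xor-same (lookup P i)) ⟩
  lookup Z i xor false                          ≡⟨ xor-identityʳ _ ⟩
  lookup Z i                                    ∎
  where open ≡-Reasoning

△-pair-≡ : ∀ {n} (X : Subset n) u → X △ (⁅ u ⁆ ∪ ⁅ u ⁆) ≡ toggle X u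
△-pair-≡ X u = lookup-ext λ i → trans (lookup-△-pair X u u i)
  (trans (cong (lookup X i xor_) (∨-idem _)) (sym (lookup-toggle X u i)))

△-pair-≢ : ∀ {n} (X : Subset n) {u v} → u ≢ v → X △ (⁅ u ⁆ ∪ ⁅ v ⁆) ≡ toggle (toggle X u) v
△-pair-≢ X {u} {v} u≢v = lookup-ext λ i → trans (lookup-△-pair X u v i) (pointwise i)
  where
  pointwise : ∀ i → lookup X i xor (⌊ u ≟ i ⌋ ∨ ⌊ v ≟ i ⌋) ≡ lookup (toggle (toggle X u) v) i
  pointwise i with u ≟ i | v ≟ i
  ... | yes refl | yes refl = contradiction refl u≢v
  ... | yes refl | no v≢u   = trans (xor-true _)
                                (sym (trans (lookup-toggle-≢ (toggle X u) v≢u) (lookup-toggle-≡ X u)))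
  ... | no u≢v′  | yes refl = trans (xor-true _)
                                (sym (trans (lookup-toggle-≡ (toggle X u) v) (cong not (lookup-toggle-≢ X u≢v′))))
  ... | no u≢i   | no v≢i   = trans (xor-identityʳ _)
                                (sym (trans (lookup-toggle-≢ (toggle X u) v≢i) (lookup-toggle-≢ X u≢i)))

module _ {n} (A : Subset n) {a b c : Fin n} (a≢b : a ≢ b) (a≢c : a ≢ c) (b≢c : b ≢ c)
         (A[a] : lookup A a ≡ true) (A[b] : lookup A b ≡ true) (A[c] : lookup A c ≡ true) where

  private
    A-a A-ab A-abc : Subset n
    A-a   = toggle A a
    A-ab  = toggle A-a b
    A-abc = toggle A-ab c

    A-a[b] : lookup (toggle A a) b ≡ true
    A-a[b] = trans (lookup-toggle-≢ A a≢b) A[b]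

    A-ab[c] : lookup (toggle (toggle A a) b) c ≡ true
    A-ab[c] = trans (lookup-toggle-≢ (toggle A a) b≢c) (trans (lookup-toggle-≢ A a≢c) A[c])

    ∣A∣≡3+∣A-abc∣ : ∣ A ∣ ≡ 3 + ∣ A-abc ∣
    ∣A∣≡3+∣A-abc∣ = trans (∣toggle∣-∈ A a A[a]) (cong suc
      (trans (∣toggle∣-∈ (toggle A a) b A-a[b]) (cong suc (∣toggle∣-∈ (toggle (toggle A a) b) c A-ab[c]))))

  three-∈⇒3≤∣∣ : 3 ≤ ∣ A ∣
  three-∈⇒3≤∣∣ = ℕₚ.≤-trans (ℕₚ.m≤m+n 3 _) (ℕₚ.≤-reflexive (sym ∣A∣≡3+∣A-abc∣))

  exactly-three⇒∣∣≡3 : (∀ x → lookup A x ≡ true → x ≡ a ⊎ x ≡ b ⊎ x ≡ c) → ∣ A ∣ ≡ 3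
  exactly-three⇒∣∣≡3 ⊆abc = trans ∣A∣≡3+∣A-abc∣ (cong (3 +_) (trans (cong ∣_∣ A-abc≡∅) (Subsetₚ.∣⊥∣≡0 n)))
    where
    A-abc≡∅ : A-abc ≡ ∅
    A-abc≡∅ = lookup-ext λ i → trans (pointwise i) (sym (lookup-∅ i))
      where
      pointwise : ∀ i → lookup A-abc i ≡ false
      pointwise i with c ≟ i
      ... | yes refl = trans (lookup-toggle-≡ A-ab c) (cong not A-ab[c])
      ... | no c≢i with b ≟ i
      ...   | yes refl = trans (lookup-toggle-≢ A-ab c≢i) (trans (lookup-toggle-≡ A-a b) (cong not A-a[b]))
      ...   | no b≢i with a ≟ i
      ...     | yes refl = trans (lookup-toggle-≢ A-ab c≢i)
                             (trans (lookup-toggle-≢ A-a b≢i) (trans (lookup-toggle-≡ A a) (cong not A[a])))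
      ...     | no a≢i = trans (lookup-toggle-≢ A-ab c≢i) (trans (lookup-toggle-≢ A-a b≢i)
                  (trans (lookup-toggle-≢ A a≢i)
                    (¬-not λ A[i] → [ a≢i ∘ sym , [ b≢i ∘ sym , c≢i ∘ sym ]′ ]′ (⊆abc i A[i]))))

∣toggle∣-≡ : ∀ {n} (A : Subset n) {x y} → lookup A x ≡ lookup A y → ∣ toggle A x ∣ ≡ ∣ toggle A y ∣
∣toggle∣-≡ A {x} {y} A[x]≡A[y] with lookup A x in A[x]
... | true  = ℕₚ.suc-injective (trans (sym (∣toggle∣-∈ A x A[x])) (∣toggle∣-∈ A y (sym A[x]≡A[y])))
... | false = trans (∣toggle∣-∉ A x A[x]) (sym (∣toggle∣-∉ A y (sym A[x]≡A[y])))

∣toggle²∣-≢ : ∀ {n} (A : Subset n) {x y} → x ≢ y → lookup A x ≢ lookup A y → ∣ toggle (toggle A x) y ∣ ≡ ∣ A ∣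
∣toggle²∣-≢ A {x} {y} x≢y A[x]≢A[y] with lookup A x in A[x] | lookup A y in A[y]
... | true  | true  = contradiction refl A[x]≢A[y]
... | false | false = contradiction refl A[x]≢A[y]
... | true  | false =
  trans (∣toggle∣-∉ (toggle A x) y (trans (lookup-toggle-≢ A x≢y) A[y])) (sym (∣toggle∣-∈ A x A[x]))
... | false | true  = ℕₚ.suc-injective
  (trans (sym (∣toggle∣-∈ (toggle A x) y (trans (lookup-toggle-≢ A x≢y) A[y]))) (∣toggle∣-∉ A x A[x]))

module _ {n} (A : Subset n) {x y : Fin n} (x≢y : x ≢ y) where

  ∣toggle²∣-∉ : lookup A x ≡ false → lookup A y ≡ false → ∣ toggle (toggle A x) y ∣ ≡ 2 + ∣ A ∣
  ∣toggle²∣-∉ A[x] A[y] =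
    trans (∣toggle∣-∉ (toggle A x) y (trans (lookup-toggle-≢ A x≢y) A[y])) (cong suc (∣toggle∣-∉ A x A[x]))

  ∣toggle²∣-∈ : lookup A x ≡ true → lookup A y ≡ true → ∣ A ∣ ≡ 2 + ∣ toggle (toggle A x) y ∣
  ∣toggle²∣-∈ A[x] A[y] =
    trans (∣toggle∣-∈ A x A[x]) (cong suc (∣toggle∣-∈ (toggle A x) y (trans (lookup-toggle-≢ A x≢y) A[y])))

∣toggle²∣-≡ : ∀ {n} (A : Subset n) {x y x′ y′} → x ≢ y → x′ ≢ y′ →
  lookup A x ≡ lookup A y → lookup A x′ ≡ lookup A x → lookup A y′ ≡ lookup A x →
  ∣ toggle (toggle A x) y ∣ ≡ ∣ toggle (toggle A x′) y′ ∣
∣toggle²∣-≡ A {x} x≢y x′≢y′ A[x]≡A[y] A[x′]≡A[x] A[y′]≡A[x] with lookup A x in A[x]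
... | true  = ℕₚ.+-cancelˡ-≡ 2 _ _ (trans (sym (∣toggle²∣-∈ A x≢y A[x] (sym A[x]≡A[y])))
                                          (∣toggle²∣-∈ A x′≢y′ A[x′]≡A[x] A[y′]≡A[x]))
... | false = trans (∣toggle²∣-∉ A x≢y A[x] (sym A[x]≡A[y])) (sym (∣toggle²∣-∉ A x′≢y′ A[x′]≡A[x] A[y′]≡A[x]))

∧-true⁻ : ∀ {a b} → a ∧ b ≡ true → a ≡ true × b ≡ true
∧-true⁻ {true} b≡true = refl , b≡true

∁-involutive : ∀ {n} (A : Subset n) → ∁ (∁ A) ≡ A
∁-involutive A = lookup-ext λ i →
  trans (lookup-∁ (∁ A) i) (trans (cong not (lookup-∁ A i)) (not-involutive _))

HasFeasibleOfSize : ∀ {n} → SetSystem n → ℕ → Set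
HasFeasibleOfSize S k = ∃ λ F → Feasible S F × ∣ F ∣ ≡ k

layer⁺ : ∀ {n} (S : SetSystem n) {A} → Feasible S A → Feasible (layer S ∣ A ∣) A
layer⁺ S {A} SA rewrite SA = Equivalence.to T-≡ (ℕₚ.≡⇒≡ᵇ ∣ A ∣ ∣ A ∣ refl)

layer⁻ : ∀ {n} (S : SetSystem n) {k A} → Feasible (layer S k) A → Feasible S A × ∣ A ∣ ≡ k
layer⁻ S {k} {A} e = let (SA , ≡ᵇ) = ∧-true⁻ e in SA , ℕₚ.≡ᵇ⇒≡ ∣ A ∣ k (Equivalence.from T-≡ ≡ᵇ)

independent? : ∀ {n} (𝓑 : SetSystem n) P → Dec (Independent 𝓑 P)
independent? 𝓑 P = anySubset? λ B → (𝓑 B ≟ᵇ true) ×-dec (P Subsetₚ.⊆? B)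

independent-⊆ : ∀ {n} {𝓑 : SetSystem n} {P Q} → P ⊆ Q → Independent 𝓑 Q → Independent 𝓑 P
independent-⊆ P⊆Q (B , 𝓑B , Q⊆B) = B , 𝓑B , Q⊆B ∘ P⊆Q

⊂⇒⊆-remove : ∀ {n} {P D : Subset n} → P ⊂ D → ∃ λ w → w ∈ D × P ⊆ D - w
⊂⇒⊆-remove (P⊆D , w , w∈D , w∉P) =
  w , w∈D , λ x∈P → Subsetₚ.x∈p∧x≢y⇒x∈p-y (P⊆D x∈P) λ { refl → w∉P x∈P }

-- Remove elements from a dependent set while it stays dependent.
dependent⇒∃circuit : ∀ {n} (𝓑 : SetSystem n) D → ¬ Independent 𝓑 D →
  ∃ λ C → Circuit 𝓑 C × ∣ C ∣ ≤ ∣ D ∣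
dependent⇒∃circuit 𝓑 D = shrink ∣ D ∣ D ℕₚ.≤-refl
  where
  shrink : ∀ m D → ∣ D ∣ ≤ m → ¬ Independent 𝓑 D → ∃ λ C → Circuit 𝓑 C × ∣ C ∣ ≤ ∣ D ∣
  shrink m D ∣D∣≤m dep with any? (λ x → (x Subsetₚ.∈? D) ×-dec ¬? (independent? 𝓑 (D - x)))
  shrink zero D ∣D∣≤0 dep | yes (x , x∈D , _) =
    contradiction (ℕₚ.<-≤-trans (Subsetₚ.x∈p⇒∣p-x∣<∣p∣ x∈D) ∣D∣≤0) ℕₚ.n≮0
  shrink (suc m) D ∣D∣≤m dep | yes (x , x∈D , dep′) =
    let ∣D-x∣<∣D∣ = Subsetₚ.x∈p⇒∣p-x∣<∣p∣ x∈D
        (C , circuit , ∣C∣≤) = shrink m (D - x) (ℕₚ.≤-pred (ℕₚ.<-≤-trans ∣D-x∣<∣D∣ ∣D∣≤m)) dep′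
    in C , circuit , ℕₚ.≤-trans ∣C∣≤ (ℕₚ.<⇒≤ ∣D-x∣<∣D∣)
  shrink m D _ dep | no minimal = D , (dep , proper⇒independent) , ℕₚ.≤-refl
    where
    proper⇒independent : ∀ P → P ⊂ D → Independent 𝓑 P
    proper⇒independent P P⊂D with ⊂⇒⊆-remove P⊂D
    ... | w , w∈D , P⊆D-w with independent? 𝓑 (D - w)
    ...   | yes indep = independent-⊆ P⊆D-w indep
    ...   | no dep′   = contradiction (w , w∈D , dep′) minimal

paving⇒independent : ∀ {n} {𝓑 : SetSystem n} → IsPaving 𝓑 → ∀ {B P} →
  Feasible 𝓑 B → ∣ P ∣ < ∣ B ∣ → Independent 𝓑 P
paving⇒independent {𝓑 = 𝓑} paving {B} {P} 𝓑B ∣P∣<∣B∣ with independent? 𝓑 P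
... | yes indep = indep
... | no dep with dependent⇒∃circuit 𝓑 P dep
...   | C , circuit , ∣C∣≤∣P∣ =
  contradiction (paving C B circuit 𝓑B) (ℕₚ.<⇒≱ (ℕₚ.≤-<-trans ∣C∣≤∣P∣ ∣P∣<∣B∣))

-- The complement of J is independent in the dual matroid.
dualPaving⇒basis-⊆ : ∀ {n} {𝓑 : SetSystem n} → IsPaving (dualBases 𝓑) → ∀ {B J} →
  Feasible 𝓑 B → ∣ B ∣ < ∣ J ∣ → ∃ λ B′ → Feasible 𝓑 B′ × B′ ⊆ J
dualPaving⇒basis-⊆ {𝓑 = 𝓑} dualPaving {B} {J} 𝓑B ∣B∣<∣J∣
  with paving⇒independent dualPaving {∁ B} {∁ J} (trans (cong 𝓑 (∁-involutive B)) 𝓑B) ∣∁J∣<∣∁B∣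
  where
  ∣∁J∣<∣∁B∣ : ∣ ∁ J ∣ < ∣ ∁ B ∣
  ∣∁J∣<∣∁B∣ rewrite Subsetₚ.∣∁p∣≡n∸∣p∣ J | Subsetₚ.∣∁p∣≡n∸∣p∣ B =
    ℕₚ.∸-monoʳ-< ∣B∣<∣J∣ (Subsetₚ.∣p∣≤n J)
... | B* , 𝓑∁B* , ∁J⊆B* = ∁ B* , 𝓑∁B* , λ x∈∁B* → Subsetₚ.x∉∁p⇒x∈p (Subsetₚ.x∈∁p⇒x∉p x∈∁B* ∘ ∁J⊆B*)

⊈⇒∃∈∉ : ∀ {n} {P R : Subset n} → ¬ R ⊆ P → ∃ λ w → w ∈ R × w ∉ P
⊈⇒∃∈∉ {P = P} {R} R⊈P with any? (λ w → (w Subsetₚ.∈? R) ×-dec ¬? (w Subsetₚ.∈? P))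
... | yes w = w
... | no ∄w = contradiction (λ {x} x∈R → decidable-stable (x Subsetₚ.∈? P) λ x∉P → ∄w (x , x∈R , x∉P)) R⊈P

⊆∧∣≥∣⇒≡ : ∀ {n} {P R : Subset n} → P ⊆ R → ∣ R ∣ ≤ ∣ P ∣ → P ≡ R
⊆∧∣≥∣⇒≡ {P = P} {R} P⊆R ∣R∣≤∣P∣ with R Subsetₚ.⊆? P
... | yes R⊆P = Subsetₚ.⊆-antisym P⊆R R⊆P
... | no R⊈P  = let (w , w∈R , w∉P) = ⊈⇒∃∈∉ R⊈P in
  contradiction (Subsetₚ.p⊂q⇒∣p∣<∣q∣ (P⊆R , w , w∈R , w∉P)) (ℕₚ.≤⇒≯ ∣R∣≤∣P∣)

⊆∧∣suc∣⇒≡toggle : ∀ {n} {P R : Subset n} → P ⊆ R → ∣ R ∣ ≡ suc ∣ P ∣ →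
  ∃ λ c → lookup P c ≡ false × R ≡ toggle P c
⊆∧∣suc∣⇒≡toggle {P = P} {R} P⊆R ∣R∣≡1+∣P∣ with ⊈⇒∃∈∉ {P = P} {R} R⊈P
  where
  R⊈P : ¬ R ⊆ P
  R⊈P R⊆P = ℕₚ.<⇒≱ (ℕₚ.≤-reflexive (sym ∣R∣≡1+∣P∣)) (Subsetₚ.p⊆q⇒∣p∣≤∣q∣ R⊆P)
... | c , c∈R , c∉P = c , ∉⇒lookup c∉P , (begin
  R                         ≡⟨ toggle-involutive R c ⟨
  toggle (toggle R c) c     ≡⟨ cong (λ Z → toggle Z c) P≡R-c ⟨
  toggle P c                ∎)
  where
  open ≡-Reasoning
  P⊆R-c : P ⊆ toggle R c
  P⊆R-c {x} x∈P = lookup⇒∈ (trans (lookup-toggle-≢ R λ { refl → c∉P x∈P }) (∈⇒lookup (P⊆R x∈P)))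
  P≡R-c : P ≡ toggle R c
  P≡R-c = ⊆∧∣≥∣⇒≡ P⊆R-c (ℕₚ.≤-reflexive (ℕₚ.suc-injective
            (trans (sym (∣toggle∣-∈ R c (∈⇒lookup c∈R))) ∣R∣≡1+∣P∣)))

remove-toggle : ∀ {n} (Q : Subset n) c → lookup Q c ≡ false → toggle Q c - c ≡ Q
remove-toggle Q c Q[c] = lookup-ext pointwise
  where
  pointwise : ∀ i → lookup (toggle Q c - c) i ≡ lookup Q i
  pointwise i with c ≟ i
  ... | yes refl = trans (lookup-remove-≡ (toggle Q c) c) (sym Q[c])
  ... | no c≢i   = trans (lookup-remove-≢ (toggle Q c) c≢i) (lookup-toggle-≢ Q c≢i)

∪⁅⁆-toggle : ∀ {n} (Q : Subset n) y → lookup Q y ≡ false → Q ∪ ⁅ y ⁆ ≡ toggle Q y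
∪⁅⁆-toggle Q y Q[y] = lookup-ext λ i → trans (lookup-∪ Q ⁅ y ⁆ i) (pointwise i)
  where
  pointwise : ∀ i → lookup Q i ∨ lookup ⁅ y ⁆ i ≡ lookup (toggle Q y) i
  pointwise i with y ≟ i
  ... | yes refl = trans (cong (lookup Q y ∨_) (lookup-⁅x⁆-x y))
                     (trans (∨-zeroʳ _) (sym (trans (lookup-toggle-≡ Q y) (cong not Q[y]))))
  ... | no y≢i   = trans (cong (lookup Q i ∨_) (lookup-⁅x⁆-≢ y≢i))
                     (trans (∨-identityʳ _) (sym (lookup-toggle-≢ Q y≢i)))

sparsePaving-exchange : ∀ {n} {𝓑 : SetSystem n} → IsSparsePavingMatroid 𝓑 →
  ∀ {Q a b} → a ≢ b → lookup Q a ≡ false → lookup Q b ≡ false →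
  (∀ B → Feasible 𝓑 B → ∣ B ∣ ≡ suc ∣ Q ∣) → Feasible 𝓑 (toggle Q a) ⊎ Feasible 𝓑 (toggle Q b)
sparsePaving-exchange {𝓑 = 𝓑} (((F , 𝓑F) , exchange) , paving , dualPaving) {Q} {a} {b} a≢b Q[a] Q[b] rank
  with 𝓑 (toggle Q a) in 𝓑Q+a | 𝓑 (toggle Q b) in 𝓑Q+b
... | true  | _     = inj₁ refl
... | false | true  = inj₂ refl
... | false | false = ⊥-elim (no-basis-⊇Q (paving⇒independent paving 𝓑F (ℕₚ.≤-reflexive (sym (rank F 𝓑F)))))
  where
  -- Q + c is a basis, Q + a + b contains a basis, and exchanging c in the
  -- former for an element of the latter produces Q + a or Q + b.
  no-basis-⊇Q : Independent 𝓑 Q → ⊥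
  no-basis-⊇Q (B₁ , 𝓑B₁ , Q⊆B₁) with ⊆∧∣suc∣⇒≡toggle Q⊆B₁ (rank B₁ 𝓑B₁)
  ... | c , Q[c] , refl = exchange-c (dualPaving⇒basis-⊆ dualPaving 𝓑B₁ ∣Q+c∣<∣J∣)
    where
    J = toggle (toggle Q a) b

    ∣Q+c∣<∣J∣ : ∣ toggle Q c ∣ < ∣ J ∣
    ∣Q+c∣<∣J∣ rewrite ∣toggle∣-∉ (toggle Q a) b (trans (lookup-toggle-≢ Q a≢b) Q[b])
                    | ∣toggle∣-∉ Q a Q[a] | ∣toggle∣-∉ Q c Q[c] = ℕₚ.≤-refl

    ≢a : ∀ {x} → Feasible 𝓑 (toggle Q x) → x ≢ a
    ≢a 𝓑Q+x refl = true≢false (trans (sym 𝓑Q+x) 𝓑Q+a)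

    ≢b : ∀ {x} → Feasible 𝓑 (toggle Q x) → x ≢ b
    ≢b 𝓑Q+x refl = true≢false (trans (sym 𝓑Q+x) 𝓑Q+b)

    J-outside : ∀ {x} → x ≢ a → x ≢ b → lookup J x ≡ lookup Q x
    J-outside x≢a x≢b = trans (lookup-toggle-≢ (toggle Q a) (x≢b ∘ sym)) (lookup-toggle-≢ Q (x≢a ∘ sym))

    J[c] : lookup J c ≡ false
    J[c] = trans (J-outside (≢a 𝓑B₁) (≢b 𝓑B₁)) Q[c]

    exchange-c : (∃ λ B₂ → Feasible 𝓑 B₂ × B₂ ⊆ J) → ⊥
    exchange-c (B₂ , 𝓑B₂ , B₂⊆J)
      with exchange (toggle Q c) B₂ 𝓑B₁ 𝓑B₂ c (lookup⇒∈ (trans (lookup-toggle-≡ Q c) (cong not Q[c])))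
                    (lookup⇒∉ J[c] ∘ B₂⊆J)
    ... | y , y∈B₂ , y∉Q+c , 𝓑Q+c-c+y = true≢false (trans (sym J[y]) (trans (J-outside (≢a 𝓑Q+y) (≢b 𝓑Q+y)) Q[y]))
      where
      J[y] : lookup J y ≡ true
      J[y] = ∈⇒lookup (B₂⊆J y∈B₂)
      Q[y] : lookup Q y ≡ false
      Q[y] = trans (sym (lookup-toggle-≢ Q λ { refl → true≢false (trans (sym J[y]) J[c]) })) (∉⇒lookup y∉Q+c)
      𝓑Q+y : Feasible 𝓑 (toggle Q y)
      𝓑Q+y = subst (Feasible 𝓑) (trans (cong (_∪ ⁅ y ⁆) (remove-toggle Q c Q[c])) (∪⁅⁆-toggle Q y Q[y]))
               𝓑Q+c-c+y

SparseExchange : ∀ {n} → SetSystem n → Set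
SparseExchange {n} S = ∀ {Q : Subset n} {a b} → a ≢ b → lookup Q a ≡ false → lookup Q b ≡ false →
  HasFeasibleOfSize S (suc ∣ Q ∣) → Feasible S (toggle Q a) ⊎ Feasible S (toggle Q b)

sparsePaving⇒sparseExchange : ∀ {n} {S : SetSystem n} → IsSparsePavingSetSystem S → SparseExchange S
sparsePaving⇒sparseExchange {S = S} (_ , stack) {Q} a≢b Q[a] Q[b] (F , SF , ∣F∣≡1+∣Q∣) =
  Sum.map (proj₁ ∘ layer⁻ S) (proj₁ ∘ layer⁻ S)
    (sparsePaving-exchange (stack _ (F , F∈layer)) a≢b Q[a] Q[b] λ _ → proj₂ ∘ layer⁻ S)
  where
  F∈layer : Feasible (layer S (suc ∣ Q ∣)) F
  F∈layer = subst (λ k → Feasible (layer S k) F) ∣F∣≡1+∣Q∣ (layer⁺ S SF)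

sparseExchange-toggle : ∀ {n} {S : SetSystem n} → SparseExchange S →
  ∀ {A : Subset n} {a c} → a ≢ c → lookup A a ≡ lookup A c → HasFeasibleOfSize S ∣ toggle A a ∣ →
  Feasible S (toggle A a) ⊎ Feasible S (toggle A c)
sparseExchange-toggle {S = S} exchange {A} {a} {c} a≢c A[a]≡A[c] (F , SF , ∣F∣) with lookup A a in A[a]
... | false = exchange a≢c A[a] (sym A[a]≡A[c]) (F , SF , trans ∣F∣ (∣toggle∣-∉ A a A[a]))
... | true  = Sum.swap (Sum.map (subst (Feasible S) Q+a≡A-c) (subst (Feasible S) Q+c≡A-a)
                (exchange a≢c Q[a] Q[c] (F , SF , trans ∣F∣ (∣toggle∣-∈ (toggle A a) c A-a[c]))))
  where
  Q = toggle (toggle A a) c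
  A-a[c] : lookup (toggle A a) c ≡ true
  A-a[c] = trans (lookup-toggle-≢ A a≢c) (sym A[a]≡A[c])
  Q[a] : lookup Q a ≡ false
  Q[a] = trans (lookup-toggle-≢ (toggle A a) (a≢c ∘ sym)) (trans (lookup-toggle-≡ A a) (cong not A[a]))
  Q[c] : lookup Q c ≡ false
  Q[c] = trans (lookup-toggle-≡ (toggle A a) c) (cong not A-a[c])
  Q+a≡A-c : toggle Q a ≡ toggle A c
  Q+a≡A-c = trans (toggle-comm (toggle A a) c a) (cong (λ Z → toggle Z c) (toggle-involutive A a))
  Q+c≡A-a : toggle Q c ≡ toggle A a
  Q+c≡A-a = toggle-involutive (toggle A a) c

-- Minors fixing some coordinates

-- step e true contracts e, step e false deletes it.
data Reduction : ℕ → ℕ → Set where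
  done : ∀ {n} → Reduction n n
  step : ∀ {n m} → Fin (suc n) → Bool → Reduction n m → Reduction (suc n) m

reduce : ∀ {n m} → Reduction n m → SetSystem n → SetSystem m
reduce done         S = S
reduce (step e b r) S = reduce r (λ A → S (insertAt A e b))

extend : ∀ {n m} → Reduction n m → Subset m → Subset n
extend done         A = A
extend (step e b r) A = insertAt (extend r A) e b

reduce-extend : ∀ {n m} (r : Reduction n m) (S : SetSystem n) A → reduce r S A ≡ S (extend r A)
reduce-extend done         S A = refl
reduce-extend (step e b r) S A = reduce-extend r _ A

Compatible : ∀ {n m} → Reduction n m → Subset n → Set
Compatible done         F = ⊤
Compatible (step e b r) F = lookup F e ≡ b × Compatible r (removeAt F e)

reinsert-removeAt : ∀ {n} {F : Subset (suc n)} {e b} → lookup F e ≡ b → insertAt (removeAt F e) e b ≡ F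
reinsert-removeAt {F = F} {e} refl = Vecₚ.insertAt-removeAt F e

-- A feasible set compatible with the reduction witnesses that no element
-- contracted is a loop and no element deleted is a coloop.
reduce-minor : ∀ {n k m} {S : SetSystem n} {M : SetSystem k} (r : Reduction k m) F →
  Minor S M → Feasible M F → Compatible r F → Minor S (reduce r M)
reduce-minor done F S≥M _ _ = S≥M
reduce-minor {M = M} (step e true r) F S≥M MF (F[e] , compatible) =
  reduce-minor r (removeAt F e) (contract-step e S≥M λ loop → loop F MF (lookup⇒∈ F[e]))
    (trans (cong M (reinsert-removeAt F[e])) MF) compatible
reduce-minor {M = M} (step e false r) F S≥M MF (F[e] , compatible) =
  reduce-minor r (removeAt F e) (delete-step e S≥M λ coloop → lookup⇒∉ F[e] (coloop F MF))
    (trans (cong M (reinsert-removeAt F[e])) MF) compatible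

Pattern : ℕ → Set
Pattern = Vec (Maybe Bool)

free : ∀ {n} → Pattern n → ℕ
free []            = 0
free (nothing ∷ p) = suc (free p)
free (just _ ∷ p)  = free p

fixedTrue : ∀ {n} → Pattern n → ℕ
fixedTrue []               = 0
fixedTrue (nothing ∷ p)    = fixedTrue p
fixedTrue (just true ∷ p)  = suc (fixedTrue p)
fixedTrue (just false ∷ p) = fixedTrue p

fill : ∀ {n} (p : Pattern n) → Subset (free p) → Subset n
fill []            A       = []
fill (nothing ∷ p) (a ∷ A) = a ∷ fill p A
fill (just b ∷ p)  A       = b ∷ fill p A

restrict : ∀ {n} (p : Pattern n) → Subset n → Subset (free p)
restrict []            Z       = []
restrict (nothing ∷ p) (z ∷ Z) = z ∷ restrict p Z
restrict (just b ∷ p)  (z ∷ Z) = restrict p Z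

position : ∀ {n} (p : Pattern n) → Fin (free p) → Fin n
position (nothing ∷ p) zero    = zero
position (nothing ∷ p) (suc i) = suc (position p i)
position (just _ ∷ p)  i       = suc (position p i)

Matches : ∀ {n} → Pattern n → Subset n → Set
Matches []            []      = ⊤
Matches (nothing ∷ p) (z ∷ Z) = Matches p Z
Matches (just b ∷ p)  (z ∷ Z) = z ≡ b × Matches p Z

shift : ∀ {n m} → Reduction n m → Reduction (suc n) (suc m)
shift done         = done
shift (step e b r) = step (suc e) b (shift r)

extend-shift : ∀ {n m} (r : Reduction n m) a A → extend (shift r) (a ∷ A) ≡ a ∷ extend r A
extend-shift done         a A = refl
extend-shift (step e b r) a A = cong (λ Z → insertAt Z (suc e) b) (extend-shift r a A)

compatible-shift : ∀ {n m} (r : Reduction n m) a F → Compatible r F → Compatible (shift r) (a ∷ F)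
compatible-shift done         a F         _                   = tt
compatible-shift (step e b r) a (f ∷ F) (F[e] , compatible) = F[e] , compatible-shift r a _ compatible

reduction : ∀ {n} (p : Pattern n) → Reduction n (free p)
reduction []            = done
reduction (nothing ∷ p) = shift (reduction p)
reduction (just b ∷ p)  = step zero b (reduction p)

extend-reduction : ∀ {n} (p : Pattern n) A → extend (reduction p) A ≡ fill p A
extend-reduction []            []      = refl
extend-reduction (nothing ∷ p) (a ∷ A) =
  trans (extend-shift (reduction p) a A) (cong (a ∷_) (extend-reduction p A))
extend-reduction (just b ∷ p)  A       = cong (λ Z → insertAt Z zero b) (extend-reduction p A)

compatible-reduction : ∀ {n} (p : Pattern n) F → Matches p F → Compatible (reduction p) F
compatible-reduction []            []      _                = tt
compatible-reduction (nothing ∷ p) (f ∷ F) matches          =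
  compatible-shift (reduction p) f F (compatible-reduction p F matches)
compatible-reduction (just b ∷ p)  (f ∷ F) (refl , matches) = refl , compatible-reduction p F matches

pattern-minor : ∀ {n} (S : SetSystem n) (p : Pattern n) {F} → Matches p F → Feasible S F →
  Σ (SetSystem (free p)) λ M → Minor S M × (∀ A → M A ≡ S (fill p A))
pattern-minor S p {F} matches SF =
  reduce (reduction p) S ,
  reduce-minor (reduction p) F self SF (compatible-reduction p F matches) ,
  λ A → trans (reduce-extend (reduction p) S A) (cong S (extend-reduction p A))

fill-restrict : ∀ {n} (p : Pattern n) Z → Matches p Z → fill p (restrict p Z) ≡ Z
fill-restrict []            []      _                = refl
fill-restrict (nothing ∷ p) (z ∷ Z) matches          = cong (z ∷_) (fill-restrict p Z matches)
fill-restrict (just b ∷ p)  (z ∷ Z) (refl , matches) = cong (z ∷_) (fill-restrict p Z matches)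

restrict-fill : ∀ {n} (p : Pattern n) A → restrict p (fill p A) ≡ A
restrict-fill []            []      = refl
restrict-fill (nothing ∷ p) (a ∷ A) = cong (a ∷_) (restrict-fill p A)
restrict-fill (just b ∷ p)  A       = restrict-fill p A

matches-fill : ∀ {n} (p : Pattern n) A → Matches p (fill p A)
matches-fill []            []      = tt
matches-fill (nothing ∷ p) (a ∷ A) = matches-fill p A
matches-fill (just b ∷ p)  A       = refl , matches-fill p A

lookup-fill : ∀ {n} (p : Pattern n) A i → lookup (fill p A) (position p i) ≡ lookup A i
lookup-fill (nothing ∷ p) (a ∷ A) zero    = refl
lookup-fill (nothing ∷ p) (a ∷ A) (suc i) = lookup-fill p A i
lookup-fill (just b ∷ p)  A       i       = lookup-fill p A i

lookup-restrict : ∀ {n} (p : Pattern n) Z i → lookup (restrict p Z) i ≡ lookup Z (position p i)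
lookup-restrict (nothing ∷ p) (z ∷ Z) zero    = refl
lookup-restrict (nothing ∷ p) (z ∷ Z) (suc i) = lookup-restrict p Z i
lookup-restrict (just b ∷ p)  (z ∷ Z) i       = lookup-restrict p Z i

position-injective : ∀ {n} (p : Pattern n) {i j} → position p i ≡ position p j → i ≡ j
position-injective (nothing ∷ p) {zero}  {zero}  _ = refl
position-injective (nothing ∷ p) {suc i} {suc j} e = cong suc (position-injective p (Finₚ.suc-injective e))
position-injective (just b ∷ p)                  e = position-injective p (Finₚ.suc-injective e)

fill-toggle : ∀ {n} (p : Pattern n) A i → fill p (toggle A i) ≡ toggle (fill p A) (position p i)
fill-toggle (nothing ∷ p) (a ∷ A) zero    = refl
fill-toggle (nothing ∷ p) (a ∷ A) (suc i) = cong (a ∷_) (fill-toggle p A i)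
fill-toggle (just b ∷ p)  A       i       = cong (b ∷_) (fill-toggle p A i)

∣fill∣ : ∀ {n} (p : Pattern n) A → ∣ fill p A ∣ ≡ fixedTrue p + ∣ A ∣
∣fill∣ []               []         = refl
∣fill∣ (nothing ∷ p)    (true ∷ A)  = trans (cong suc (∣fill∣ p A)) (sym (ℕₚ.+-suc _ _))
∣fill∣ (nothing ∷ p)    (false ∷ A) = ∣fill∣ p A
∣fill∣ (just true ∷ p)  A          = cong suc (∣fill∣ p A)
∣fill∣ (just false ∷ p) A          = ∣fill∣ p A

differencePattern : ∀ {n} → Subset n → Subset n → Pattern n
differencePattern []      []      = []
differencePattern (x ∷ X) (y ∷ Y) = (if x xor y then nothing else just x) ∷ differencePattern X Y

Between : ∀ {n} → Subset n → Subset n → Subset n → Set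
Between X Y Z = ∀ i → lookup X i ≡ lookup Y i → lookup Z i ≡ lookup X i

between⇒matches : ∀ {n} (X Y Z : Subset n) → Between X Y Z → Matches (differencePattern X Y) Z
between⇒matches []           []           []      _ = tt
between⇒matches (true ∷ X)  (true ∷ Y)  (z ∷ Z) b = b zero refl , between⇒matches X Y Z (b ∘ suc)
between⇒matches (false ∷ X) (false ∷ Y) (z ∷ Z) b = b zero refl , between⇒matches X Y Z (b ∘ suc)
between⇒matches (true ∷ X)  (false ∷ Y) (z ∷ Z) b = between⇒matches X Y Z (b ∘ suc)
between⇒matches (false ∷ X) (true ∷ Y)  (z ∷ Z) b = between⇒matches X Y Z (b ∘ suc)

matches⇒between : ∀ {n} (X Y Z : Subset n) → Matches (differencePattern X Y) Z → Between X Y Z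
matches⇒between (true ∷ X)  (true ∷ Y)  (z ∷ Z) (z≡x , _) zero    _ = z≡x
matches⇒between (false ∷ X) (false ∷ Y) (z ∷ Z) (z≡x , _) zero    _ = z≡x
matches⇒between (true ∷ X)  (true ∷ Y)  (z ∷ Z) (_ , m)   (suc i) e = matches⇒between X Y Z m i e
matches⇒between (false ∷ X) (false ∷ Y) (z ∷ Z) (_ , m)   (suc i) e = matches⇒between X Y Z m i e
matches⇒between (true ∷ X)  (false ∷ Y) (z ∷ Z) m         (suc i) e = matches⇒between X Y Z m i e
matches⇒between (false ∷ X) (true ∷ Y)  (z ∷ Z) m         (suc i) e = matches⇒between X Y Z m i e

free-differencePattern : ∀ {n} (X Y : Subset n) → free (differencePattern X Y) ≡ ∣ X △ Y ∣
free-differencePattern []           []           = refl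
free-differencePattern (true ∷ X)  (true ∷ Y)  = free-differencePattern X Y
free-differencePattern (false ∷ X) (false ∷ Y) = free-differencePattern X Y
free-differencePattern (true ∷ X)  (false ∷ Y) = cong suc (free-differencePattern X Y)
free-differencePattern (false ∷ X) (true ∷ Y)  = cong suc (free-differencePattern X Y)

lookup-position-differencePattern : ∀ {n} (X Y : Subset n) i →
  let x = position (differencePattern X Y) i in lookup Y x ≡ not (lookup X x)
lookup-position-differencePattern []          []          ()
lookup-position-differencePattern (true ∷ X)  (true ∷ Y)  i       = lookup-position-differencePattern X Y i
lookup-position-differencePattern (false ∷ X) (false ∷ Y) i       = lookup-position-differencePattern X Y i
lookup-position-differencePattern (true ∷ X)  (false ∷ Y) zero    = refl
lookup-position-differencePattern (false ∷ X) (true ∷ Y)  zero    = refl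
lookup-position-differencePattern (true ∷ X)  (false ∷ Y) (suc i) = lookup-position-differencePattern X Y i
lookup-position-differencePattern (false ∷ X) (true ∷ Y)  (suc i) = lookup-position-differencePattern X Y i

position-differencePattern-surjective : ∀ {n} (X Y : Subset n) x → lookup X x ≢ lookup Y x →
  ∃ λ i → position (differencePattern X Y) i ≡ x
position-differencePattern-surjective (true ∷ X)  (true ∷ Y)  zero    X≢Y = contradiction refl X≢Y
position-differencePattern-surjective (false ∷ X) (false ∷ Y) zero    X≢Y = contradiction refl X≢Y
position-differencePattern-surjective (true ∷ X)  (false ∷ Y) zero    _   = zero , refl
position-differencePattern-surjective (false ∷ X) (true ∷ Y)  zero    _   = zero , refl
position-differencePattern-surjective (x₀ ∷ X) (y₀ ∷ Y) (suc x) X≢Y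
  with position-differencePattern-surjective X Y x X≢Y
... | i , refl with x₀ | y₀
...   | true  | true  = i , refl
...   | false | false = i , refl
...   | true  | false = suc i , refl
...   | false | true  = suc i , refl

restrict-differencePattern : ∀ {n} (X Y : Subset n) →
  restrict (differencePattern X Y) Y ≡ ∁ (restrict (differencePattern X Y) X)
restrict-differencePattern X Y = lookup-ext λ i → begin
  lookup (restrict p Y) i            ≡⟨ lookup-restrict p Y i ⟩
  lookup Y (position p i)            ≡⟨ lookup-position-differencePattern X Y i ⟩
  not (lookup X (position p i))      ≡⟨ cong not (lookup-restrict p X i) ⟨
  not (lookup (restrict p X) i)      ≡⟨ lookup-∁ (restrict p X) i ⟨
  lookup (∁ (restrict p X)) i        ∎
  where
  open ≡-Reasoning
  p = differencePattern X Y

-- Set systems on three elements, by exhaustive search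

allSubsets? : ∀ {n} {P : Subset n → Set} → (∀ A → Dec (P A)) → Dec (∀ A → P A)
allSubsets? P? = map′ (λ ∄¬P A → decidable-stable (P? A) (∄¬P ∘ (A ,_)))
                      (λ ∀P (A , ¬PA) → ¬PA (∀P A))
                      (¬? (anySubset? (¬? ∘ P?)))

hasFeasibleOfSize? : ∀ {n} (S : SetSystem n) k → Dec (HasFeasibleOfSize S k)
hasFeasibleOfSize? S k = anySubset? λ F → (S F ≟ᵇ true) ×-dec (∣ F ∣ ≟ℕ k)

sparseExchange? : ∀ {n} (S : SetSystem n) → Dec (SparseExchange S)
sparseExchange? S = map′ (λ h {Q} {a} {b} → h Q a b) (λ h Q a b → h {Q} {a} {b}) $
  allSubsets? λ Q → all? λ a → all? λ b →
    ¬? (a ≟ b) →-dec (lookup Q a ≟ᵇ false) →-dec (lookup Q b ≟ᵇ false) →-dec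
    hasFeasibleOfSize? S (suc ∣ Q ∣) →-dec ((S (toggle Q a) ≟ᵇ true) ⊎-dec (S (toggle Q b) ≟ᵇ true))

-- A minimal failure of the exchange axiom seen on its difference set: X and
-- ∁ X are feasible, and ∁ X is the only feasible set on its side of u.
LocalObstruction : ∀ {m} → SetSystem m → Set
LocalObstruction {m} M = ∃₂ λ (u : Fin m) (X : Subset m) → Feasible M X × Feasible M (∁ X) ×
  (∀ Z → lookup Z u ≡ not (lookup X u) → Z ≢ ∁ X → M Z ≡ false) × SparseExchange M

localObstruction? : ∀ {m} (M : SetSystem m) → Dec (LocalObstruction M)
localObstruction? M = any? λ u → anySubset? λ X →
  (M X ≟ᵇ true) ×-dec (M (∁ X) ≟ᵇ true) ×-dec
  allSubsets? (λ Z → (lookup Z u ≟ᵇ not (lookup X u)) →-dec ¬? (Vecₚ.≡-dec _≟ᵇ_ Z (∁ X)) →-dec (M Z ≟ᵇ false))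
  ×-dec sparseExchange? M

localObstruction-≗ : ∀ {m} {M M′ : SetSystem m} → (∀ A → M A ≡ M′ A) →
  LocalObstruction M → LocalObstruction M′
localObstruction-≗ {M = M} {M′} M≗M′ (u , X , MX , M∁X , others , exchange) =
  u , X , transport MX , transport M∁X , (λ Z Z[u] Z≢∁X → trans (sym (M≗M′ Z)) (others Z Z[u] Z≢∁X)) ,
  λ a≢b Q[a] Q[b] (F , M′F , ∣F∣) →
    Sum.map transport transport (exchange a≢b Q[a] Q[b] (F , trans (M≗M′ F) M′F , ∣F∣))
  where
  transport : ∀ {A} → Feasible M A → Feasible M′ A
  transport {A} MA = trans (sym (M≗M′ A)) MA

Table : ℕ → Set
Table zero    = Bool
Table (suc n) = Table n × Table n

lookupTable : ∀ {n} → Table n → SetSystem n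
lookupTable {zero}  b       []          = b
lookupTable {suc n} (f , t) (false ∷ A) = lookupTable f A
lookupTable {suc n} (f , t) (true  ∷ A) = lookupTable t A

tableOf : ∀ {n} → SetSystem n → Table n
tableOf {zero}  S = S []
tableOf {suc n} S = tableOf (S ∘ (false ∷_)) , tableOf (S ∘ (true ∷_))

lookup-tableOf : ∀ {n} (S : SetSystem n) A → lookupTable (tableOf S) A ≡ S A
lookup-tableOf S []          = refl
lookup-tableOf S (false ∷ A) = lookup-tableOf (S ∘ (false ∷_)) A
lookup-tableOf S (true  ∷ A) = lookup-tableOf (S ∘ (true ∷_)) A

allTables : ∀ {n} → (Table n → Bool) → Bool
allTables {zero}  f = f false ∧ f true
allTables {suc n} f = allTables λ l → allTables λ r → f (l , r)

allTables-sound : ∀ {n} (f : Table n → Bool) → T (allTables f) → ∀ t → T (f t)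
allTables-sound {zero}  f all false = proj₁ (Equivalence.to T-∧ all)
allTables-sound {zero}  f all true  = proj₂ (Equivalence.to T-∧ all)
allTables-sound {suc n} f all (l , r) =
  allTables-sound (λ r → f (l , r)) (allTables-sound (λ l → allTables λ r → f (l , r)) all l) r

permutation : Fin 6 → Fin 3 → Fin 3
permutation j = lookup (lookup table j)
  where
  table : Vec (Vec (Fin 3) 3) 6
  table = (# 0 ∷ # 1 ∷ # 2 ∷ []) ∷ (# 0 ∷ # 2 ∷ # 1 ∷ []) ∷ (# 1 ∷ # 0 ∷ # 2 ∷ [])
        ∷ (# 2 ∷ # 1 ∷ # 0 ∷ []) ∷ (# 1 ∷ # 2 ∷ # 0 ∷ []) ∷ (# 2 ∷ # 0 ∷ # 1 ∷ []) ∷ []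

-- The last two permutations are 3-cycles, inverse to each other; the others are involutions.
inverse : Fin 6 → Fin 6
inverse j = lookup (# 0 ∷ # 1 ∷ # 2 ∷ # 3 ∷ # 5 ∷ # 4 ∷ []) j

permutation-inverse : ∀ j x → permutation (inverse j) (permutation j x) ≡ x
permutation-inverse = toWitness {a? = all? λ j → all? λ x → permutation (inverse j) (permutation j x) ≟ x} tt

inverse-involutive : ∀ j → inverse (inverse j) ≡ j
inverse-involutive = toWitness {a? = all? λ j → inverse (inverse j) ≟ j} tt

permutation-bijective : ∀ j → Bijective _≡_ _≡_ (permutation j)
permutation-bijective j =
  (λ {x} {y} πx≡πy → trans (sym (permutation-inverse j x))
                       (trans (cong (permutation (inverse j)) πx≡πy) (permutation-inverse j y))) ,
  λ y → permutation (inverse j) y , λ { refl → trans (cong (λ k → permutation k (permutation (inverse j) y))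
                                                       (sym (inverse-involutive j)))
                                                 (permutation-inverse (inverse j) y) }

excludedOn3 : Fin 6 → SetSystem 3
excludedOn3 j = lookup (Sys 3 ∷ T₂ ∷ dual T₂ ∷ twist T₃ setB ∷ twist T₄ setB ∷ twist T₄ setAC ∷ []) j

excludedOn3-excluded : ∀ {m} {M : SetSystem m} j → Isomorphic M (excludedOn3 j) → IsExcluded M
excludedOn3-excluded zero                                      iso = inj₁ (3 , s≤s (s≤s (s≤s z≤n)) , iso)
excludedOn3-excluded (suc zero)                                iso = inj₂ (inj₁ iso)
excludedOn3-excluded (suc (suc zero))                          iso = inj₂ (inj₂ (inj₁ iso))
excludedOn3-excluded (suc (suc (suc zero)))                    iso = inj₂ (inj₂ (inj₂ (inj₁ iso)))
excludedOn3-excluded (suc (suc (suc (suc zero))))              iso = inj₂ (inj₂ (inj₂ (inj₂ (inj₁ iso))))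
excludedOn3-excluded (suc (suc (suc (suc (suc zero)))))        iso = inj₂ (inj₂ (inj₂ (inj₂ (inj₂ iso))))

ExcludedWitness : SetSystem 3 → Set
ExcludedWitness M = ∃₂ λ j k → ∀ A → M A ≡ excludedOn3 j (image (permutation k) A)

excludedWitness? : ∀ M → Dec (ExcludedWitness M)
excludedWitness? M = any? λ j → any? λ k → allSubsets? λ A → M A ≟ᵇ excludedOn3 j (image (permutation k) A)

_⇒ᵇ_ : ∀ {O W : Set} → Dec O → Dec W → Bool
o? ⇒ᵇ w? = not (does o?) ∨ does w?

⇒ᵇ-sound : ∀ {O W : Set} (o? : Dec O) (w? : Dec W) → T (o? ⇒ᵇ w?) → O → W
⇒ᵇ-sound (yes _) (yes w) _  _   = w
⇒ᵇ-sound (yes _) (no _)  ()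
⇒ᵇ-sound (no ¬o) _       _  obs = contradiction obs ¬o

obstructed-tables-excluded :
  T (allTables λ t → localObstruction? (lookupTable t) ⇒ᵇ excludedWitness? (lookupTable t))
obstructed-tables-excluded = tt

localObstruction⇒excluded : ∀ (M : SetSystem 3) → LocalObstruction M → IsExcluded M
localObstruction⇒excluded M obstruction = excluded witness
  where
  t = tableOf M
  witness : ExcludedWitness (lookupTable t)
  witness = ⇒ᵇ-sound (localObstruction? (lookupTable t)) (excludedWitness? (lookupTable t))
    (allTables-sound (λ t → localObstruction? (lookupTable t) ⇒ᵇ excludedWitness? (lookupTable t))
                     obstructed-tables-excluded t)
    (localObstruction-≗ (λ A → sym (lookup-tableOf M A)) obstruction)
  excluded : ExcludedWitness (lookupTable t) → IsExcluded M
  excluded (j , k , iso) = excludedOn3-excluded j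
    (permutation k , permutation-bijective k , λ A → trans (sym (lookup-tableOf M A)) (iso A))

sparseExchange-pattern : ∀ {n} {S : SetSystem n} (p : Pattern n) {M : SetSystem (free p)} →
  (∀ A → M A ≡ S (fill p A)) → SparseExchange S → SparseExchange M
sparseExchange-pattern {S = S} p {M} M≗S∘fill exchange {Q} {a} {b} a≢b Q[a] Q[b] (F , MF , ∣F∣) =
  Sum.map (feasible-in-M a) (feasible-in-M b)
    (exchange (a≢b ∘ position-injective p) (trans (lookup-fill p Q a) Q[a]) (trans (lookup-fill p Q b) Q[b])
      (fill p F , trans (sym (M≗S∘fill F)) MF , ∣fillF∣))
  where
  open ≡-Reasoning
  feasible-in-M : ∀ x → Feasible S (toggle (fill p Q) (position p x)) → Feasible M (toggle Q x)
  feasible-in-M x feasible = trans (M≗S∘fill (toggle Q x)) (trans (cong S (fill-toggle p Q x)) feasible)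
  ∣fillF∣ : ∣ fill p F ∣ ≡ suc ∣ fill p Q ∣
  ∣fillF∣ = begin
    ∣ fill p F ∣               ≡⟨ ∣fill∣ p F ⟩
    fixedTrue p + ∣ F ∣        ≡⟨ cong (fixedTrue p +_) ∣F∣ ⟩
    fixedTrue p + suc ∣ Q ∣    ≡⟨ ℕₚ.+-suc _ _ ⟩
    suc (fixedTrue p + ∣ Q ∣)  ≡⟨ cong suc (∣fill∣ p Q) ⟨
    suc ∣ fill p Q ∣           ∎

module Interval {n} (X Y : Subset n) where

  Differ : Fin n → Set
  Differ x = lookup X x ≢ lookup Y x

  differ? : ∀ x → Dec (Differ x)
  differ? x = ¬? (lookup X x ≟ᵇ lookup Y x)

  agree : ∀ {x} → ¬ Differ x → lookup X x ≡ lookup Y x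
  agree {x} = decidable-stable (lookup X x ≟ᵇ lookup Y x)

  Y-differ : ∀ {x} → Differ x → lookup Y x ≡ not (lookup X x)
  Y-differ X≢Y = ¬-not (X≢Y ∘ sym)

  between-X : Between X Y X
  between-X _ _ = refl

  between-Y : Between X Y Y
  between-Y _ = sym

  between-toggle : ∀ Z {x} → Between X Y Z → Differ x → Between X Y (toggle Z x)
  between-toggle Z {x} between x-differs i X≡Y with x ≟ i
  ... | yes refl = contradiction X≡Y x-differs
  ... | no x≢i   = trans (lookup-toggle-≢ Z x≢i) (between i X≡Y)

  between-pair : ∀ Z {u v} → Between X Y Z → Differ u → Differ v → Between X Y (Z △ (⁅ u ⁆ ∪ ⁅ v ⁆))
  between-pair Z {u} {v} between u-differs v-differs i X≡Y with u ≟ i | v ≟ i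
  ... | yes refl | _        = contradiction X≡Y u-differs
  ... | no _     | yes refl = contradiction X≡Y v-differs
  ... | no u≢i   | no v≢i   = trans (lookup-△-pair Z u v i)
    (trans (cong₂ (λ a b → lookup Z i xor (a ∨ b)) (⌊≟⌋-≢ u≢i) (⌊≟⌋-≢ v≢i))
           (trans (xor-identityʳ _) (between i X≡Y)))

  △-pair≡Y : ∀ {u v} → Differ u → Differ v → (∀ x → Differ x → x ≡ u ⊎ x ≡ v) →
    X △ (⁅ u ⁆ ∪ ⁅ v ⁆) ≡ Y
  △-pair≡Y {u} {v} u-differs v-differs ⊆uv = lookup-ext λ i → trans (lookup-△-pair X u v i) (pointwise i)
    where
    pointwise : ∀ i → lookup X i xor (⌊ u ≟ i ⌋ ∨ ⌊ v ≟ i ⌋) ≡ lookup Y i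
    pointwise i with u ≟ i | v ≟ i
    ... | yes refl | _        = trans (xor-true _) (sym (Y-differ u-differs))
    ... | no _     | yes refl = trans (xor-true _) (sym (Y-differ v-differs))
    ... | no u≢i   | no v≢i   =
      trans (xor-identityʳ _) (agree λ i-differs → [ u≢i ∘ sym , v≢i ∘ sym ]′ (⊆uv i i-differs))

  pat : Pattern n
  pat = differencePattern X Y

  matches-X : Matches pat X
  matches-X = between⇒matches X Y X between-X

  matches-Y : Matches pat Y
  matches-Y = between⇒matches X Y Y between-Y

  differ-position : ∀ i → Differ (position pat i)
  differ-position i X≡Y = not-¬ refl (trans X≡Y (lookup-position-differencePattern X Y i))

  between-differ-Y : ∀ Z {i} → Between X Y Z → lookup Z i ≢ lookup Y i → Differ i
  between-differ-Y Z {i} between Z≢Y X≡Y = Z≢Y (trans (between i X≡Y) X≡Y)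

  between-differ-X : ∀ Z {i} → Between X Y Z → lookup Z i ≢ lookup X i → Differ i
  between-differ-X Z {i} between Z≢X X≡Y = Z≢X (between i X≡Y)

  fill-restrict-X : fill pat (restrict pat X) ≡ X
  fill-restrict-X = fill-restrict pat X matches-X

  fill-∁-restrict-X : fill pat (∁ (restrict pat X)) ≡ Y
  fill-∁-restrict-X =
    trans (cong (fill pat) (sym (restrict-differencePattern X Y))) (fill-restrict pat Y matches-Y)

==⇒≡ : ∀ {n} {A B : Subset n} → (A == B) ≡ true → A ≡ B
==⇒≡ A==B = toWitness (Equivalence.from T-≡ A==B)

==-refl : ∀ {n} (A : Subset n) → (A == A) ≡ true
==-refl A = Equivalence.to T-≡ (fromWitness refl)

Sys-feasible⁻ : ∀ {k} (A : Subset k) → Feasible (Sys k) A → A ≡ ∅ ⊎ A ≡ full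
Sys-feasible⁻ A feasible with A == ∅ in A==∅
... | true = inj₁ (==⇒≡ A==∅)
... | false with A == full in A==full
...   | true  = inj₂ (==⇒≡ A==full)
...   | false = contradiction feasible λ ()

Sys-feasible⁺ : ∀ {k} (A : Subset k) → A ≡ ∅ ⊎ A ≡ full → Feasible (Sys k) A
Sys-feasible⁺ {k} A (inj₁ refl) rewrite ==-refl (∅ {k}) = refl
Sys-feasible⁺ {k} A (inj₂ refl) rewrite ==-refl (full {k}) = ∨-zeroʳ (full == ∅)

anyFin-single : ∀ {n} (f : Fin n → Bool) y → (∀ x → x ≢ y → f x ≡ false) → anyFin f ≡ f y
anyFin-single f zero others =
  trans (cong (f zero ∨_) (anyFin-false (f ∘ suc) λ x → others (suc x) λ ())) (∨-identityʳ _)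
  where
  anyFin-false : ∀ {n} (g : Fin n → Bool) → (∀ x → g x ≡ false) → anyFin g ≡ false
  anyFin-false {zero}  g _      = refl
  anyFin-false {suc n} g g≗false rewrite g≗false zero = anyFin-false (g ∘ suc) (g≗false ∘ suc)
anyFin-single f (suc y) others rewrite others zero (λ ()) =
  anyFin-single (f ∘ suc) y λ x x≢y → others (suc x) (x≢y ∘ Finₚ.suc-injective)

lookup-image : ∀ {n m} (φ : Fin n → Fin m) (ψ : Fin m → Fin n) →
  (∀ {x y} → φ x ≡ φ y → x ≡ y) → (∀ y → φ (ψ y) ≡ y) →
  ∀ A y → lookup (image φ A) y ≡ lookup A (ψ y)
lookup-image φ ψ φ-injective φ∘ψ A y =
  trans (Vecₚ.lookup∘tabulate _ y) (trans (anyFin-single _ (ψ y) others) at-ψy)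
  where
  others : ∀ x → x ≢ ψ y → lookup A x ∧ ⌊ φ x ≟ y ⌋ ≡ false
  others x x≢ψy = trans (cong (lookup A x ∧_) (⌊≟⌋-≢ λ φx≡y → x≢ψy (φ-injective (trans φx≡y (sym (φ∘ψ y))))))
                        (∧-zeroʳ _)
  at-ψy : lookup A (ψ y) ∧ ⌊ φ (ψ y) ≟ y ⌋ ≡ lookup A (ψ y)
  at-ψy = trans (cong (lookup A (ψ y) ∧_) (trans (cong (λ z → ⌊ z ≟ y ⌋) (φ∘ψ y)) (⌊≟⌋-≡ y))) (∧-identityʳ _)

image-id : ∀ {n} (A : Subset n) → image (λ x → x) A ≡ A
image-id A = lookup-ext (lookup-image (λ x → x) (λ x → x) (λ e → e) (λ _ → refl) A)

-- A minimal failure of the exchange axiom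

ExchangeAt : ∀ {n} → SetSystem n → Subset n → Subset n → Fin n → Set
ExchangeAt S X Y u = ∃ λ v → lookup X v ≢ lookup Y v × Feasible S (X △ (⁅ u ⁆ ∪ ⁅ v ⁆))

ExchangeBelow : ∀ {n} → SetSystem n → ℕ → Set
ExchangeBelow {n} S d = ∀ (X Y : Subset n) → ∣ X △ Y ∣ < d → Feasible S X → Feasible S Y →
  ∀ u → lookup X u ≢ lookup Y u → ExchangeAt S X Y u

NoExcludedMinor : ∀ {n} → SetSystem n → Set
NoExcludedMinor S = ∀ {m} (M : SetSystem m) → Minor S M → ¬ IsExcluded M

≢-≢⇒≡ : ∀ {a b c : Bool} → a ≢ c → b ≢ c → a ≡ b
≢-≢⇒≡ a≢c b≢c = trans (¬-not a≢c) (sym (¬-not b≢c))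

≢⇒≡⊎≡ : ∀ {a b : Bool} c → a ≢ b → c ≡ a ⊎ c ≡ b
≢⇒≡⊎≡ {a} c a≢b with c ≟ᵇ a
... | yes c≡a = inj₁ c≡a
... | no c≢a  = inj₂ (≢-≢⇒≡ c≢a (a≢b ∘ sym))

≡-or : ∀ {n} {x : Fin n} {B : Set} y → (x ≢ y → B) → x ≡ y ⊎ B
≡-or {x = x} y x≢y⇒B with x ≟ y
... | yes x≡y = inj₁ x≡y
... | no x≢y  = inj₂ (x≢y⇒B x≢y)

module Counterexample {n} {S : SetSystem n} (exchange : SparseExchange S) (noExcluded : NoExcludedMinor S)
  {X Y : Subset n} {u : Fin n} (SX : Feasible S X) (SY : Feasible S Y) (u-differs : lookup X u ≢ lookup Y u)
  (stuck : ¬ ExchangeAt S X Y u) (below : ExchangeBelow S ∣ X △ Y ∣) where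

  open Interval X Y

  closer : ∀ Z W → (∀ i → lookup Z i ≢ lookup W i → Differ i) →
    ∀ w → Differ w → lookup Z w ≡ lookup W w → ∣ Z △ W ∣ < ∣ X △ Y ∣
  closer Z W differ⇒Differ w w-differs Z[w]≡W[w] = Subsetₚ.p⊂q⇒∣p∣<∣q∣
    ( (λ i∈Z△W → ≢⇒∈△ X Y (differ⇒Differ _ (∈△⇒≢ Z W i∈Z△W)))
    , w , ≢⇒∈△ X Y w-differs , λ w∈Z△W → ∈△⇒≢ Z W w∈Z△W Z[w]≡W[w])

  -- Otherwise X, Z is a closer pair, and an exchange at u for it would be one for X, Y.
  toward-Y-only-Y : ∀ {Z} → Feasible S Z → Between X Y Z → lookup Z u ≡ lookup Y u → Z ≡ Y
  toward-Y-only-Y {Z} SZ between Z[u] = decidable-stable (Vecₚ.≡-dec _≟ᵇ_ Z Y) λ Z≢Y →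
    let (w , Z[w]≢Y[w]) = ≢⇒∃-lookup-≢ Z≢Y
        w-differs = between-differ-Y Z between Z[w]≢Y[w]
        X[w]≡Z[w] = ≢-≢⇒≡ w-differs Z[w]≢Y[w]
        X△Z⊆D = λ i X≢Z → between-differ-X Z between (X≢Z ∘ sym)
        (v , X[v]≢Z[v] , feasible) = below X Z (closer X Z X△Z⊆D w w-differs X[w]≡Z[w])
                                       SX SZ u (λ X≡Z → u-differs (trans X≡Z Z[u]))
    in stuck (v , between-differ-X Z between (X[v]≢Z[v] ∘ sym) , feasible)

  -- An exchange at u for the closer pair Z, Y agrees with Y at u, so it is Y.
  toward-X : ∀ {Z} → Feasible S Z → Between X Y Z → lookup Z u ≡ lookup X u → Z ≢ X →
    ∃ λ v → Differ v × Z ≡ Y △ (⁅ u ⁆ ∪ ⁅ v ⁆)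
  toward-X {Z} SZ between Z[u] Z≢X =
    let (w , Z[w]≢X[w]) = ≢⇒∃-lookup-≢ Z≢X
        w-differs = between-differ-X Z between Z[w]≢X[w]
        Z[w]≡Y[w] = ≢-≢⇒≡ Z[w]≢X[w] (w-differs ∘ sym)
        (v , Z[v]≢Y[v] , SW) = below Z Y (closer Z Y (λ i → between-differ-Y Z between) w w-differs Z[w]≡Y[w])
                                 SZ SY u (λ Z≡Y → u-differs (trans (sym Z[u]) Z≡Y))
        v-differs = between-differ-Y Z between Z[v]≢Y[v]
        W≡Y = toward-Y-only-Y SW (between-pair Z between u-differs v-differs) (W[u] v)
    in v , v-differs , trans (sym (△-involutive Z _)) (cong (_△ (⁅ u ⁆ ∪ ⁅ v ⁆)) W≡Y)
    where
    W[u] : ∀ v → lookup (Z △ (⁅ u ⁆ ∪ ⁅ v ⁆)) u ≡ lookup Y u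
    W[u] v = begin
      lookup (Z △ (⁅ u ⁆ ∪ ⁅ v ⁆)) u           ≡⟨ lookup-△-pair Z u v u ⟩
      lookup Z u xor (⌊ u ≟ u ⌋ ∨ ⌊ v ≟ u ⌋)   ≡⟨ cong (λ b → lookup Z u xor (b ∨ ⌊ v ≟ u ⌋)) (⌊≟⌋-≡ u) ⟩
      lookup Z u xor true                       ≡⟨ xor-true (lookup Z u) ⟩
      not (lookup Z u)                          ≡⟨ cong not Z[u] ⟩
      not (lookup X u)                          ≡⟨ Y-differ u-differs ⟨
      lookup Y u                                ∎
      where open ≡-Reasoning

  at-most-two-differ : ∀ {p} → Differ p → ¬ (∀ x → Differ x → x ≡ u ⊎ x ≡ p)
  at-most-two-differ {p} p-differs ⊆up =
    stuck (p , p-differs , subst (Feasible S) (sym (△-pair≡Y u-differs p-differs ⊆up)) SY)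

  -- Contract what X and Y share and delete what both miss.
  restriction : Σ (SetSystem (free pat)) λ M → Minor S M × (∀ A → M A ≡ S (fill pat A))
  restriction = pattern-minor S pat matches-X SX

  exactly-three-differ : ∀ {p q} → Differ p → Differ q → p ≢ u → q ≢ u → q ≢ p →
    ¬ (∀ x → Differ x → x ≡ u ⊎ x ≡ p ⊎ x ≡ q)
  exactly-three-differ {p} {q} p-differs q-differs p≢u q≢u q≢p ⊆upq =
    noExcluded M S≥M (excluded-of-size-3 M ∣D∣≡3
      (u′ , X′ , MX′ , M∁X′ , others , sparseExchange-pattern pat M≗ exchange))
    where
    open ≡-Reasoning
    M = proj₁ restriction
    S≥M = proj₁ (proj₂ restriction)
    M≗ = proj₂ (proj₂ restriction)

    excluded-of-size-3 : ∀ {m} (M : SetSystem m) → m ≡ 3 → LocalObstruction M → IsExcluded M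
    excluded-of-size-3 M refl = localObstruction⇒excluded M

    ∣D∣≡3 : free pat ≡ 3
    ∣D∣≡3 = trans (free-differencePattern X Y)
      (exactly-three⇒∣∣≡3 (X △ Y) (p≢u ∘ sym) (q≢u ∘ sym) (q≢p ∘ sym)
        (∈⇒lookup (≢⇒∈△ X Y u-differs)) (∈⇒lookup (≢⇒∈△ X Y p-differs)) (∈⇒lookup (≢⇒∈△ X Y q-differs))
        λ x x∈D → ⊆upq x (∈△⇒≢ X Y (lookup⇒∈ x∈D)))

    u′ = proj₁ (position-differencePattern-surjective X Y u u-differs)
    u′↦u = proj₂ (position-differencePattern-surjective X Y u u-differs)
    X′ = restrict pat X

    MX′ : Feasible M X′
    MX′ = trans (M≗ X′) (trans (cong S fill-restrict-X) SX)

    M∁X′ : Feasible M (∁ X′)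
    M∁X′ = trans (M≗ (∁ X′)) (trans (cong S fill-∁-restrict-X) SY)

    others : ∀ Z′ → lookup Z′ u′ ≡ not (lookup X′ u′) → Z′ ≢ ∁ X′ → M Z′ ≡ false
    others Z′ Z′[u′] Z′≢∁X′ = ¬-not λ MZ′ → Z′≢∁X′ (begin
      Z′                          ≡⟨ restrict-fill pat Z′ ⟨
      restrict pat (fill pat Z′)  ≡⟨ cong (restrict pat) (toward-Y-only-Y (trans (sym (M≗ Z′)) MZ′)
                                       (matches⇒between X Y _ (matches-fill pat Z′)) Z[u]) ⟩
      restrict pat Y              ≡⟨ restrict-differencePattern X Y ⟩
      ∁ X′                        ∎)
      where
      Z[u] : lookup (fill pat Z′) u ≡ lookup Y u
      Z[u] = begin
        lookup (fill pat Z′) u                ≡⟨ cong (lookup (fill pat Z′)) u′↦u ⟨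
        lookup (fill pat Z′) (position pat u′) ≡⟨ lookup-fill pat Z′ u′ ⟩
        lookup Z′ u′                          ≡⟨ Z′[u′] ⟩
        not (lookup X′ u′)                    ≡⟨ cong not (lookup-restrict pat X u′) ⟩
        not (lookup X (position pat u′))      ≡⟨ cong (not ∘ lookup X) u′↦u ⟩
        not (lookup X u)                      ≡⟨ Y-differ u-differs ⟨
        lookup Y u                            ∎

  Y+x-infeasible : ∀ {x} → Differ x → x ≢ u → ¬ Feasible S (toggle Y x)
  Y+x-infeasible {x} x-differs x≢u feasible = not-¬ refl (sym (begin
    not (lookup Y x)          ≡⟨ lookup-toggle-≡ Y x ⟨
    lookup (toggle Y x) x     ≡⟨ cong (λ Z → lookup Z x) Y+x≡Y ⟩
    lookup Y x                ∎))
    where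
    open ≡-Reasoning
    Y+x≡Y = toward-Y-only-Y feasible (between-toggle Y between-Y x-differs) (lookup-toggle-≢ Y x≢u)

  Y+x+y-infeasible : ∀ {x y} → Differ x → Differ y → x ≢ u → y ≢ u → x ≢ y →
    ¬ Feasible S (toggle (toggle Y x) y)
  Y+x+y-infeasible {x} {y} x-differs y-differs x≢u y≢u x≢y feasible = not-¬ refl (sym (begin
    not (lookup Y y)                  ≡⟨ cong not (lookup-toggle-≢ Y x≢y) ⟨
    not (lookup (toggle Y x) y)       ≡⟨ lookup-toggle-≡ (toggle Y x) y ⟨
    lookup (toggle (toggle Y x) y) y  ≡⟨ cong (λ Z → lookup Z y) Y+x+y≡Y ⟩
    lookup Y y                        ∎))
    where
    open ≡-Reasoning
    Y+x+y≡Y = toward-Y-only-Y feasible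
      (between-toggle (toggle Y x) (between-toggle Y between-Y x-differs) y-differs)
      (trans (lookup-toggle-≢ (toggle Y x) y≢u) (lookup-toggle-≢ Y x≢u))

  module AtLeastFour {p q s} (p-differs : Differ p) (q-differs : Differ q) (s-differs : Differ s)
    (p≢u : p ≢ u) (q≢u : q ≢ u) (s≢u : s ≢ u) (q≢p : q ≢ p) (s≢p : s ≢ p) (s≢q : s ≢ q) where

    third : ∀ a b → ∃ λ c → Differ c × c ≢ u × c ≢ a × c ≢ b
    third a b with p ≟ a | p ≟ b | q ≟ a | q ≟ b
    ... | no p≢a  | no p≢b  | _       | _       = p , p-differs , p≢u , p≢a , p≢b
    ... | _       | _       | no q≢a  | no q≢b  = q , q-differs , q≢u , q≢a , q≢b
    ... | yes p≡a | _       | yes q≡a | _       = contradiction (trans q≡a (sym p≡a)) q≢p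
    ... | no _    | yes p≡b | _       | yes q≡b = contradiction (trans q≡b (sym p≡b)) q≢p
    ... | yes p≡a | _       | no _    | yes q≡b =
      s , s-differs , s≢u , (λ s≡a → s≢p (trans s≡a (sym p≡a))) , (λ s≡b → s≢q (trans s≡b (sym q≡b)))
    ... | no _    | yes p≡b | yes q≡a | _       =
      s , s-differs , s≢u , (λ s≡a → s≢q (trans s≡a (sym q≡a))) , (λ s≡b → s≢p (trans s≡b (sym p≡b)))

    -- Sparse exchange at Y + b for a and c, whose two outcomes are ruled out
    -- by Y+x+y-infeasible.
    X-split-impossible : ∀ {a b c} → Differ a → Differ b → Differ c → a ≢ u → b ≢ u → c ≢ u →
      a ≢ b → a ≢ c → b ≢ c → lookup X c ≡ lookup X a → lookup X a ≢ lookup X b → ⊥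
    X-split-impossible {a} {b} {c} a-differs b-differs c-differs a≢u b≢u c≢u a≢b a≢c b≢c
                       X[c]≡X[a] X[a]≢X[b] =
      [ Y+x+y-infeasible b-differs a-differs b≢u a≢u (a≢b ∘ sym)
      , Y+x+y-infeasible b-differs c-differs b≢u c≢u b≢c ]′
      (sparseExchange-toggle exchange a≢c Y+b[a]≡Y+b[c] (Y , SY , sym (∣toggle²∣-≢ Y (a≢b ∘ sym) Y[b]≢Y[a])))
      where
      Y+b[a]≡Y+b[c] : lookup (toggle Y b) a ≡ lookup (toggle Y b) c
      Y+b[a]≡Y+b[c] = trans (lookup-toggle-≢ Y (a≢b ∘ sym)) (trans (Y-differ a-differs)
        (trans (cong not (sym X[c]≡X[a])) (trans (sym (Y-differ c-differs)) (sym (lookup-toggle-≢ Y b≢c)))))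
      Y[b]≢Y[a] : lookup Y b ≢ lookup Y a
      Y[b]≢Y[a] Y[b]≡Y[a] = X[a]≢X[b] (sym (not-injective
        (trans (sym (Y-differ b-differs)) (trans Y[b]≡Y[a] (Y-differ a-differs)))))

    X-constant-off-u : ∀ {a b} → Differ a → Differ b → a ≢ u → b ≢ u → lookup X a ≡ lookup X b
    X-constant-off-u {a} {b} a-differs b-differs a≢u b≢u with a ≟ b
    ... | yes refl = refl
    ... | no a≢b = decidable-stable (lookup X a ≟ᵇ lookup X b) λ X[a]≢X[b] →
      let (c , c-differs , c≢u , c≢a , c≢b) = third a b in
      [ (λ X[c]≡X[a] → X-split-impossible a-differs b-differs c-differs a≢u b≢u c≢u
                          a≢b (c≢a ∘ sym) (c≢b ∘ sym) X[c]≡X[a] X[a]≢X[b])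
      , (λ X[c]≡X[b] → X-split-impossible b-differs a-differs c-differs b≢u a≢u c≢u
                          (a≢b ∘ sym) (c≢b ∘ sym) (c≢a ∘ sym) X[c]≡X[b] (X[a]≢X[b] ∘ sym)) ]′
      (≢⇒≡⊎≡ (lookup X c) X[a]≢X[b])

    -- Otherwise sparse exchange at X + u for p and q yields X △ {u, p} or X △ {u, q}.
    X[u]≡X[p] : lookup X u ≡ lookup X p
    X[u]≡X[p] = decidable-stable (lookup X u ≟ᵇ lookup X p) λ X[u]≢X[p] →
      [ (λ feasible → stuck (p , p-differs , subst (Feasible S) (sym (△-pair-≢ X (p≢u ∘ sym))) feasible))
      , (λ feasible → stuck (q , q-differs , subst (Feasible S) (sym (△-pair-≢ X (q≢u ∘ sym))) feasible)) ]′
      (sparseExchange-toggle exchange (q≢p ∘ sym) X+u[p]≡X+u[q]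
        (X , SX , sym (∣toggle²∣-≢ X (p≢u ∘ sym) X[u]≢X[p])))
      where
      X+u[p]≡X+u[q] : lookup (toggle X u) p ≡ lookup (toggle X u) q
      X+u[p]≡X+u[q] = trans (lookup-toggle-≢ X (p≢u ∘ sym))
        (trans (X-constant-off-u p-differs q-differs p≢u q≢u) (sym (lookup-toggle-≢ X (q≢u ∘ sym))))

    X-constant : ∀ {x} → Differ x → lookup X x ≡ lookup X u
    X-constant {x} x-differs with x ≟ u
    ... | yes refl = refl
    ... | no x≢u   = trans (X-constant-off-u x-differs p-differs x≢u p≢u) (sym X[u]≡X[p])

    Y-constant : ∀ {x} → Differ x → lookup Y x ≡ lookup Y u
    Y-constant x-differs =
      trans (Y-differ x-differs) (trans (cong not (X-constant x-differs)) (sym (Y-differ u-differs)))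

    Y+u-infeasible : ¬ Feasible S (toggle Y u)
    Y+u-infeasible feasible =
      [ Y+x-infeasible p-differs p≢u , Y+x-infeasible q-differs q≢u ]′
      (sparseExchange-toggle exchange (q≢p ∘ sym) (trans (Y-constant p-differs) (sym (Y-constant q-differs)))
        (toggle Y u , feasible , ∣toggle∣-≡ Y (sym (Y-constant p-differs))))

    Y+u+w-infeasible : ∀ {w} → Differ w → w ≢ u → ¬ Feasible S (toggle (toggle Y u) w)
    Y+u+w-infeasible {w} w-differs w≢u feasible =
      [ Y+x+y-infeasible p-differs q-differs p≢u q≢u (q≢p ∘ sym)
      , Y+x+y-infeasible p-differs s-differs p≢u s≢u (s≢p ∘ sym) ]′
      (sparseExchange-toggle exchange (s≢q ∘ sym) Y+p[q]≡Y+p[s]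
        (toggle (toggle Y u) w , feasible ,
         ∣toggle²∣-≡ Y (w≢u ∘ sym) (q≢p ∘ sym)
           (sym (Y-constant w-differs)) (Y-constant p-differs) (Y-constant q-differs)))
      where
      Y+p[q]≡Y+p[s] : lookup (toggle Y p) q ≡ lookup (toggle Y p) s
      Y+p[q]≡Y+p[s] = trans (lookup-toggle-≢ Y (q≢p ∘ sym))
        (trans (Y-constant q-differs) (trans (sym (Y-constant s-differs)) (sym (lookup-toggle-≢ Y (s≢p ∘ sym)))))

    Y△uv-infeasible : ∀ {v} → Differ v → ¬ Feasible S (Y △ (⁅ u ⁆ ∪ ⁅ v ⁆))
    Y△uv-infeasible {v} v-differs feasible =
      [ (λ { refl → Y+u-infeasible (subst (Feasible S) (△-pair-≡ Y u) feasible) })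
      , (λ u≢v → Y+u+w-infeasible v-differs (u≢v ∘ sym) (subst (Feasible S) (△-pair-≢ Y u≢v) feasible)) ]′
      (toSum (u ≟ v))

    between-feasible : ∀ {Z} → Feasible S Z → Between X Y Z → Z ≡ X ⊎ Z ≡ Y
    between-feasible {Z} SZ between =
      [ toward-X-side , (λ Z[u]≢X[u] → inj₂ (toward-Y-only-Y SZ between (≢-≢⇒≡ Z[u]≢X[u] (u-differs ∘ sym)))) ]′
      (toSum (lookup Z u ≟ᵇ lookup X u))
      where
      toward-X-side : lookup Z u ≡ lookup X u → Z ≡ X ⊎ Z ≡ Y
      toward-X-side Z[u]≡X[u] = Sum.map₂ (λ Z≢X → ⊥-elim (
        let (v , v-differs , Z≡Y△uv) = toward-X SZ between Z[u]≡X[u] Z≢X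
        in Y△uv-infeasible v-differs (subst (Feasible S) Z≡Y△uv SZ))) (toSum (Vecₚ.≡-dec _≟ᵇ_ Z X))

    restrict-X-constant : restrict pat X ≡ replicate (free pat) (lookup X u)
    restrict-X-constant = lookup-ext λ i → trans (lookup-restrict pat X i)
      (trans (X-constant (differ-position i)) (sym (Vecₚ.lookup-replicate i (lookup X u))))

    endpoints : ∀ A → (A ≡ restrict pat X ⊎ A ≡ restrict pat Y) ⇔ (A ≡ ∅ ⊎ A ≡ full)
    endpoints A rewrite restrict-differencePattern X Y | restrict-X-constant
                      | Vecₚ.map-replicate not (lookup X u) (free pat) with lookup X u
    ... | true  = mk⇔ Sum.swap Sum.swap
    ... | false = mk⇔ (λ e → e) (λ e → e)

    restriction-≅-Sys : Isomorphic (proj₁ restriction) (Sys (free pat))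
    restriction-≅-Sys = (λ x → x) , ((λ e → e) , λ y → y , λ e → e) ,
      λ A → trans (M≡Sys A) (cong (Sys (free pat)) (sym (image-id A)))
      where
      M = proj₁ restriction
      M≗ = proj₂ (proj₂ restriction)
      M≡Sys : ∀ A → M A ≡ Sys (free pat) A
      M≡Sys A = ⇔→≡ (mk⇔ to from)
        where
        restrict-of : ∀ {Z} → fill pat A ≡ Z → A ≡ restrict pat Z
        restrict-of fill-A≡Z = trans (sym (restrict-fill pat A)) (cong (restrict pat) fill-A≡Z)
        to : Feasible M A → Feasible (Sys (free pat)) A
        to MA = Sys-feasible⁺ A (Equivalence.to (endpoints A) (Sum.map restrict-of restrict-of
          (between-feasible (trans (sym (M≗ A)) MA) (matches⇒between X Y _ (matches-fill pat A)))))
        from : Feasible (Sys (free pat)) A → Feasible M A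
        from SysA = trans (M≗ A)
          ([ (λ A≡X′ → trans (cong (S ∘ fill pat) A≡X′) (trans (cong S fill-restrict-X) SX))
           , (λ A≡Y′ → trans (cong (S ∘ fill pat) A≡Y′) (trans (cong S (fill-restrict pat Y matches-Y)) SY))
           ]′ (Equivalence.from (endpoints A) (Sys-feasible⁻ A SysA)))

    at-least-four-impossible : ⊥
    at-least-four-impossible = noExcluded (proj₁ restriction) (proj₁ (proj₂ restriction))
      (inj₁ (free pat , 3≤∣D∣ , restriction-≅-Sys))
      where
      3≤∣D∣ : 3 ≤ free pat
      3≤∣D∣ = subst (3 ≤_) (sym (free-differencePattern X Y))
        (three-∈⇒3≤∣∣ (X △ Y) (p≢u ∘ sym) (q≢u ∘ sym) (q≢p ∘ sym)
          (∈⇒lookup (≢⇒∈△ X Y u-differs)) (∈⇒lookup (≢⇒∈△ X Y p-differs)) (∈⇒lookup (≢⇒∈△ X Y q-differs)))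

  three-or-more-differ : ∀ {p q} → Differ p → Differ q → p ≢ u → q ≢ u → q ≢ p → ⊥
  three-or-more-differ {p} {q} p-differs q-differs p≢u q≢u q≢p =
    [ (λ { (s , s-differs , s≢u , s≢p , s≢q) →
           AtLeastFour.at-least-four-impossible p-differs q-differs s-differs p≢u q≢u s≢u q≢p s≢p s≢q })
    , (λ ∄s → exactly-three-differ p-differs q-differs p≢u q≢u q≢p λ x x-differs →
           ≡-or u λ x≢u → ≡-or p λ x≢p → decidable-stable (x ≟ q) λ x≢q → ∄s (x , x-differs , x≢u , x≢p , x≢q))
    ]′ (toSum (any? λ s → differ? s ×-dec ¬? (s ≟ u) ×-dec ¬? (s ≟ p) ×-dec ¬? (s ≟ q)))

  two-or-more-differ : ∀ {p} → Differ p → p ≢ u → ⊥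
  two-or-more-differ {p} p-differs p≢u =
    [ (λ { (q , q-differs , q≢u , q≢p) → three-or-more-differ p-differs q-differs p≢u q≢u q≢p })
    , (λ ∄q → at-most-two-differ p-differs λ x x-differs →
           ≡-or u λ x≢u → decidable-stable (x ≟ p) λ x≢p → ∄q (x , x-differs , x≢u , x≢p))
    ]′ (toSum (any? λ q → differ? q ×-dec ¬? (q ≟ u) ×-dec ¬? (q ≟ p)))

  impossible : ⊥
  impossible =
    [ (λ { (p , p-differs , p≢u) → two-or-more-differ p-differs p≢u })
    , (λ ∄p → at-most-two-differ u-differs λ x x-differs →
           inj₁ (decidable-stable (x ≟ u) λ x≢u → ∄p (x , x-differs , x≢u)))
    ]′ (toSum (any? λ p → differ? p ×-dec ¬? (p ≟ u)))

exchangeAt? : ∀ {n} (S : SetSystem n) X Y u → Dec (ExchangeAt S X Y u)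
exchangeAt? S X Y u = any? λ v → Interval.differ? X Y v ×-dec (S (X △ (⁅ u ⁆ ∪ ⁅ v ⁆)) ≟ᵇ true)

exchangeBelow : ∀ {n} {S : SetSystem n} → SparseExchange S → NoExcludedMinor S → ∀ d → ExchangeBelow S d
exchangeBelow exchange noExcluded zero    X Y ()
exchangeBelow {S = S} exchange noExcluded (suc d) X Y ∣X△Y∣≤d SX SY u u-differs =
  decidable-stable (exchangeAt? S X Y u) λ stuck →
    Counterexample.impossible exchange noExcluded SX SY u-differs stuck λ X′ Y′ closer →
      exchangeBelow exchange noExcluded d X′ Y′ (ℕₚ.<-≤-trans closer (ℕₚ.≤-pred ∣X△Y∣≤d))

noExcludedMinor⇒deltaMatroid : ∀ {n} {S : SetSystem n} → IsSparsePavingSetSystem S → NoExcludedMinor S →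
  IsDeltaMatroid S
noExcludedMinor⇒deltaMatroid sparsePaving noExcluded = proj₁ sparsePaving , λ X Y SX SY u u∈X△Y →
  let (v , v-differs , feasible) = exchangeBelow (sparsePaving⇒sparseExchange sparsePaving) noExcluded
                                     _ X Y ℕₚ.≤-refl SX SY u (∈△⇒≢ X Y u∈X△Y)
  in v , ≢⇒∈△ X Y v-differs , feasible

-- Minors and isomorphic copies of delta-matroids

insertAt-zipWith : ∀ {n} (f : Bool → Bool → Bool) (A B : Subset n) e a b →
  zipWith f (insertAt A e a) (insertAt B e b) ≡ insertAt (zipWith f A B) e (f a b)
insertAt-zipWith f A       B       zero    a b = refl
insertAt-zipWith f (x ∷ A) (y ∷ B) (suc e) a b = cong (f x y ∷_) (insertAt-zipWith f A B e a b)

insertAt-∅ : ∀ {n} (e : Fin (suc n)) → insertAt ∅ e false ≡ ∅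
insertAt-∅ {n}     zero    = refl
insertAt-∅ {suc n} (suc e) = cong (false ∷_) (insertAt-∅ e)

⁅punchIn⁆ : ∀ {n} (e : Fin (suc n)) u → ⁅ punchIn e u ⁆ ≡ insertAt ⁅ u ⁆ e false
⁅punchIn⁆ zero    u       = refl
⁅punchIn⁆ (suc e) zero    = cong (true ∷_) (sym (insertAt-∅ e))
⁅punchIn⁆ (suc e) (suc u) = cong (false ∷_) (⁅punchIn⁆ e u)

insertAt-△-pair : ∀ {n} (X : Subset n) e b u v →
  insertAt X e b △ (⁅ punchIn e u ⁆ ∪ ⁅ punchIn e v ⁆) ≡ insertAt (X △ (⁅ u ⁆ ∪ ⁅ v ⁆)) e b
insertAt-△-pair X e b u v
  rewrite ⁅punchIn⁆ e u | ⁅punchIn⁆ e v | insertAt-zipWith _∨_ ⁅ u ⁆ ⁅ v ⁆ e false false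
        | insertAt-zipWith _xor_ X (⁅ u ⁆ ∪ ⁅ v ⁆) e b false | xor-identityʳ b = refl

deltaMatroid-fix : ∀ {n} {M : SetSystem (suc n)} e b → IsDeltaMatroid M →
  (∃ λ A → Feasible M A × lookup A e ≡ b) → IsDeltaMatroid (λ A → M (insertAt A e b))
deltaMatroid-fix {M = M} e b (_ , exchange) (A , MA , A[e]) =
  (removeAt A e , trans (cong M (reinsert-removeAt A[e])) MA) , exchange-fixed
  where
  exchange-fixed : ∀ X Y → Feasible M (insertAt X e b) → Feasible M (insertAt Y e b) → ∀ u → u ∈ X △ Y →
    ∃ λ v → v ∈ X △ Y × Feasible M (insertAt (X △ (⁅ u ⁆ ∪ ⁅ v ⁆)) e b)
  exchange-fixed X Y MX MY u u∈X△Y with exchange _ _ MX MY (punchIn e u) (≢⇒∈△ _ _ u-differs)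
    where
    u-differs : lookup (insertAt X e b) (punchIn e u) ≢ lookup (insertAt Y e b) (punchIn e u)
    u-differs rewrite Vecₚ.insertAt-punchIn X e b u | Vecₚ.insertAt-punchIn Y e b u = ∈△⇒≢ X Y u∈X△Y
  ... | v , v∈ , feasible = punchOut e≢v , ≢⇒∈△ X Y v′-differs ,
    subst (Feasible M) (trans (cong (λ w → _ △ (_ ∪ ⁅ w ⁆)) (sym e↑v′≡v)) (insertAt-△-pair X e b u _)) feasible
    where
    e≢v : e ≢ v
    e≢v refl = ∈△⇒≢ _ _ v∈ (trans (Vecₚ.insertAt-lookup X e b) (sym (Vecₚ.insertAt-lookup Y e b)))
    e↑v′≡v : punchIn e (punchOut e≢v) ≡ v
    e↑v′≡v = Finₚ.punchIn-punchOut e≢v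
    v′-differs : lookup X (punchOut e≢v) ≢ lookup Y (punchOut e≢v)
    v′-differs X≡Y = ∈△⇒≢ _ _ v∈ (subst (λ w → lookup (insertAt X e b) w ≡ lookup (insertAt Y e b) w) e↑v′≡v
      (trans (Vecₚ.insertAt-punchIn X e b _) (trans X≡Y (sym (Vecₚ.insertAt-punchIn Y e b _)))))

feasible-with : ∀ {n} (M : SetSystem n) e b → ¬ (∀ A → Feasible M A → lookup A e ≢ b) →
  ∃ λ A → Feasible M A × lookup A e ≡ b
feasible-with M e b ∄A = decidable-stable (anySubset? λ A → (M A ≟ᵇ true) ×-dec (lookup A e ≟ᵇ b))
  λ ∄A′ → ∄A λ A MA A[e]≡b → ∄A′ (A , MA , A[e]≡b)

deltaMatroid-minor : ∀ {n m} {S : SetSystem n} {M : SetSystem m} → IsDeltaMatroid S → Minor S M → IsDeltaMatroid M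
deltaMatroid-minor dS self = dS
deltaMatroid-minor dS (contract-step {M = M} e S≥M ¬loop) = deltaMatroid-fix e true (deltaMatroid-minor dS S≥M)
  (feasible-with M e true λ ∄A → ¬loop λ A MA e∈A → ∄A A MA (∈⇒lookup e∈A))
deltaMatroid-minor dS (delete-step {M = M} e S≥M ¬coloop) = deltaMatroid-fix e false (deltaMatroid-minor dS S≥M)
  (feasible-with M e false λ ∄A → ¬coloop λ A MA → lookup⇒∈ (¬-not (∄A A MA)))

⌊≟⌋-cong : ∀ {n m} {a b : Fin n} {c d : Fin m} → (a ≡ b → c ≡ d) → (c ≡ d → a ≡ b) → ⌊ a ≟ b ⌋ ≡ ⌊ c ≟ d ⌋
⌊≟⌋-cong {a = a} {b} {c} {d} to from with a ≟ b | c ≟ d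
... | yes _   | yes _   = refl
... | no _    | no _    = refl
... | yes a≡b | no c≢d  = contradiction (to a≡b) c≢d
... | no a≢b  | yes c≡d = contradiction (from c≡d) a≢b

deltaMatroid-iso : ∀ {m k} {M : SetSystem m} {T : SetSystem k} →
  IsDeltaMatroid M → Isomorphic M T → IsDeltaMatroid T
deltaMatroid-iso {m} {k} {M} {T} ((A , MA) , exchange) (φ , (φ-injective , φ-surjective) , M≗T∘φ) =
  (image φ A , trans (sym (M≗T∘φ A)) MA) , exchange-T
  where
  open ≡-Reasoning
  ψ : Fin k → Fin m
  ψ y = proj₁ (φ-surjective y)
  φ∘ψ : ∀ y → φ (ψ y) ≡ y
  φ∘ψ y = proj₂ (φ-surjective y) refl

  preimage : Subset k → Subset m
  preimage Z = tabulate (lookup Z ∘ φ)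

  lookup-preimage : ∀ Z x → lookup (preimage Z) x ≡ lookup Z (φ x)
  lookup-preimage Z = Vecₚ.lookup∘tabulate (lookup Z ∘ φ)

  lookup-preimage-ψ : ∀ Z y → lookup (preimage Z) (ψ y) ≡ lookup Z y
  lookup-preimage-ψ Z y = trans (lookup-preimage Z (ψ y)) (cong (lookup Z) (φ∘ψ y))

  T≗M∘preimage : ∀ Z → T Z ≡ M (preimage Z)
  T≗M∘preimage Z = sym (trans (M≗T∘φ (preimage Z)) (cong T (lookup-ext λ y →
    trans (lookup-image φ ψ φ-injective φ∘ψ (preimage Z) y) (lookup-preimage-ψ Z y))))

  preimage-△-pair : ∀ Z u v → preimage (Z △ (⁅ u ⁆ ∪ ⁅ φ v ⁆)) ≡ preimage Z △ (⁅ ψ u ⁆ ∪ ⁅ v ⁆)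
  preimage-△-pair Z u v = lookup-ext λ x → begin
    lookup (preimage (Z △ (⁅ u ⁆ ∪ ⁅ φ v ⁆))) x          ≡⟨ lookup-preimage (Z △ (⁅ u ⁆ ∪ ⁅ φ v ⁆)) x ⟩
    lookup (Z △ (⁅ u ⁆ ∪ ⁅ φ v ⁆)) (φ x)                 ≡⟨ lookup-△-pair Z u (φ v) (φ x) ⟩
    lookup Z (φ x) xor (⌊ u ≟ φ x ⌋ ∨ ⌊ φ v ≟ φ x ⌋)     ≡⟨ cong₂ (λ a b → lookup Z (φ x) xor (a ∨ b))
      (⌊≟⌋-cong (λ u≡φx → φ-injective (trans (φ∘ψ u) u≡φx)) (λ ψu≡x → trans (sym (φ∘ψ u)) (cong φ ψu≡x)))
      (⌊≟⌋-cong φ-injective (cong φ)) ⟩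
    lookup Z (φ x) xor (⌊ ψ u ≟ x ⌋ ∨ ⌊ v ≟ x ⌋)
      ≡⟨ cong (_xor (⌊ ψ u ≟ x ⌋ ∨ ⌊ v ≟ x ⌋)) (lookup-preimage Z x) ⟨
    lookup (preimage Z) x xor (⌊ ψ u ≟ x ⌋ ∨ ⌊ v ≟ x ⌋)  ≡⟨ lookup-△-pair (preimage Z) (ψ u) v x ⟨
    lookup (preimage Z △ (⁅ ψ u ⁆ ∪ ⁅ v ⁆)) x             ∎

  exchange-T : ∀ X Y → Feasible T X → Feasible T Y → ∀ u → u ∈ X △ Y →
    ∃ λ v → v ∈ X △ Y × Feasible T (X △ (⁅ u ⁆ ∪ ⁅ v ⁆))
  exchange-T X Y TX TY u u∈X△Y =
    let (v , v∈ , feasible) = exchange (preimage X) (preimage Y)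
          (trans (sym (T≗M∘preimage X)) TX) (trans (sym (T≗M∘preimage Y)) TY) (ψ u) (≢⇒∈△ _ _ λ pre-X≡pre-Y →
            ∈△⇒≢ X Y u∈X△Y (trans (sym (lookup-preimage-ψ X u)) (trans pre-X≡pre-Y (lookup-preimage-ψ Y u))))
    in φ v , ≢⇒∈△ X Y (λ X≡Y → ∈△⇒≢ _ _ v∈ (trans (lookup-preimage X v) (trans X≡Y (sym (lookup-preimage Y v))))) ,
       trans (T≗M∘preimage _) (trans (cong M (preimage-△-pair X u v)) feasible)

-- The excluded set systems are not delta-matroids

Violation : ∀ {k} → SetSystem k → Set
Violation {k} T = ∃₂ λ (X Y : Subset k) → Feasible T X × Feasible T Y ×
  ∃ λ u → u ∈ X △ Y × ∀ v → T (X △ (⁅ u ⁆ ∪ ⁅ v ⁆)) ≡ false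

violation⇒¬deltaMatroid : ∀ {k} {T : SetSystem k} → Violation T → ¬ IsDeltaMatroid T
violation⇒¬deltaMatroid (X , Y , TX , TY , u , u∈X△Y , stuck) (_ , exchange) =
  let (v , _ , feasible) = exchange X Y TX TY u u∈X△Y in true≢false (trans (sym feasible) (stuck v))

violation? : ∀ {k} (T : SetSystem k) → Dec (Violation T)
violation? T = anySubset? λ X → anySubset? λ Y →
  (T X ≟ᵇ true) ×-dec (T Y ≟ᵇ true) ×-dec any? λ u →
  (u Subsetₚ.∈? X △ Y) ×-dec all? λ v → T (X △ (⁅ u ⁆ ∪ ⁅ v ⁆)) ≟ᵇ false

excludedOn3-violation : ∀ j → Violation (excludedOn3 j)
excludedOn3-violation = toWitness {a? = all? λ j → violation? (excludedOn3 j)} tt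

Sys-violation : ∀ j → Violation (Sys (3 + j))
Sys-violation j =
  ∅ , full , Sys-feasible⁺ {3 + j} ∅ (inj₁ refl) , Sys-feasible⁺ {3 + j} full (inj₂ refl) ,
  zero , lookup⇒∈ refl , λ { zero → refl ; (suc zero) → refl ; (suc (suc _)) → refl }

isomorphic-violation : ∀ {m k} {M : SetSystem m} {T : SetSystem k} →
  Violation T → Isomorphic M T → ¬ IsDeltaMatroid M
isomorphic-violation violation iso deltaMatroid =
  violation⇒¬deltaMatroid violation (deltaMatroid-iso deltaMatroid iso)

excluded⇒¬deltaMatroid : ∀ {m} {M : SetSystem m} → IsExcluded M → ¬ IsDeltaMatroid M
excluded⇒¬deltaMatroid (inj₁ (_ , s≤s (s≤s (s≤s z≤n)) , iso)) = isomorphic-violation (Sys-violation _) iso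
excluded⇒¬deltaMatroid (inj₂ (inj₁ iso))                       = isomorphic-violation (excludedOn3-violation (# 1)) iso
excluded⇒¬deltaMatroid (inj₂ (inj₂ (inj₁ iso)))                = isomorphic-violation (excludedOn3-violation (# 2)) iso
excluded⇒¬deltaMatroid (inj₂ (inj₂ (inj₂ (inj₁ iso))))         = isomorphic-violation (excludedOn3-violation (# 3)) iso
excluded⇒¬deltaMatroid (inj₂ (inj₂ (inj₂ (inj₂ (inj₁ iso)))))  = isomorphic-violation (excludedOn3-violation (# 4)) iso
excluded⇒¬deltaMatroid (inj₂ (inj₂ (inj₂ (inj₂ (inj₂ iso)))))  = isomorphic-violation (excludedOn3-violation (# 5)) iso

deltaMatroid⇒noExcludedMinor : ∀ {n} {S : SetSystem n} → IsDeltaMatroid S → NoExcludedMinor S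
deltaMatroid⇒noExcludedMinor deltaMatroid M S≥M excluded =
  excluded⇒¬deltaMatroid excluded (deltaMatroid-minor deltaMatroid S≥M)

corollary6p10 : ∀ {n} (S : SetSystem n) → IsSparsePavingSetSystem S →
    (IsSparsePavingDeltaMatroid S →
       ∀ {m} (M : SetSystem m) → Minor S M → ¬ IsExcluded M)
    × ((∀ {m} (M : SetSystem m) → Minor S M → ¬ IsExcluded M) →
       IsSparsePavingDeltaMatroid S)
corollary6p10 S sparsePaving =
  (λ (_ , deltaMatroid) → deltaMatroid⇒noExcludedMinor deltaMatroid) ,
  (λ noExcluded → sparsePaving , noExcludedMinor⇒deltaMatroid sparsePaving noExcluded)
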